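{- Let $n\geq 3$ and $m\geq 2n$ be integers and let $p=\frac{1}{2}\binom{2n}{n}-1$. Then $$\operatorname{rank} H_p\big(\mathcal{VR}(\mathcal{F}_n^{[m]};2(n-1))\big)\geq\binom{m}{2n}.$$ Equivalently, since $\mathcal{VR}(\mathcal{F}_n^{[2n+k]};2(n-1))=\operatorname{Ind}(\mathrm{KG}(n,k))$, the $p$-dimensional homology of the independence complex of the Kneser graph $\mathrm{KG}(n,k)$ has rank at least $\binom{2n+k}{2n}$ for every $k\ge 0$.
   Context: $[m]=\{1,\dots,m\}$. $\mathcal{F}_n^{[m]}$ is the set of $n$-element subsets of $[m]$ with metric $d(A,B)=|A\triangle B|$. For a metric space $(X,d)$ and $r\ge 0$, $\mathcal{VR}(X;r)$ is the simplicial complex on $X$ whose simplices are the nonempty finite $\tau\subseteq X$ with $d(x,y)\le r$ for all $x,y\in\tau$. The Kneser graph $\mathrm{KG}(n,k)$ has vertex set the $n$-subsets of $[2n+k]$, two being adjacent iff disjoint; $\operatorname{Ind}(G)$ is the simplicial complex of independent vertex sets of $G$. Homology is simplicial homology (with real coefficients; rank means dimension).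
   Formalization: The coefficient field of the homology is ℚ rather than the real numbers. -}

module Defs where

open import Data.Bool using (Bool; true; false; if_then_else_)
open import Data.Bool.Properties using () renaming (_≟_ to _≟ᵇ_)
open import Data.Nat using (ℕ; zero; suc; _≤_; _≤?_)
import Data.Nat.Properties as ℕP
open import Data.Fin using (Fin)
open import Data.Vec using (Vec; []; _∷_)
import Data.Vec.Properties as VecP
open import Data.List using (List; []; _∷_; [_]; _++_; map; filter; length; lookup)
import Data.List.Properties as ListP
open import Data.List.Relation.Unary.All using (All; all?)
open import Data.Rational using (ℚ; 0ℚ; 1ℚ; _+_; _*_; -_)
open import Data.Unit using (⊤)
open import Relation.Nullary using (does)
open import Relation.Binary.PropositionalEquality using (_≡_)
open import Relation.Binary.Definitions using (DecidableEquality)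

-- A subset of [m] = {1..m} is its characteristic vector.
Subset : ℕ → Set
Subset m = Vec Bool m

card : ∀ {m} → Subset m → ℕ
card [] = 0
card (true ∷ xs) = suc (card xs)
card (false ∷ xs) = card xs

symDiffDist : ∀ {m} → Subset m → Subset m → ℕ
symDiffDist [] [] = 0
symDiffDist (x ∷ xs) (y ∷ ys) =
  if does (x ≟ᵇ y) then symDiffDist xs ys else suc (symDiffDist xs ys)

allSubsets : (m : ℕ) → List (Subset m)
allSubsets zero = [ [] ]
allSubsets (suc m) = map (true ∷_) (allSubsets m) ++ map (false ∷_) (allSubsets m)

F : (n m : ℕ) → List (Subset m)
F n m = filter (λ A → card A ℕP.≟ n) (allSubsets m)

subset-≟ : ∀ {m} → DecidableEquality (Subset m)
subset-≟ = VecP.≡-dec _≟ᵇ_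

-- Vietoris–Rips complex of a finite metric space given by a
-- duplicate-free list of points X and an ℕ-valued metric d.

module _ {A : Set} where

  combinations : ℕ → List A → List (List A)
  combinations zero xs = [ [] ]
  combinations (suc k) [] = []
  combinations (suc k) (x ∷ xs) =
    map (x ∷_) (combinations k xs) ++ combinations (suc k) xs

  -- the k-simplices of VR(X; r): (k+1)-element subsets τ ⊆ X with
  -- d(x,y) ≤ r for all x,y ∈ τ; each simplex listed once, with its
  -- vertices ordered as in X (this fixes its orientation).
  VRsimplices : (d : A → A → ℕ) (r : ℕ) (X : List A) (k : ℕ) → List (List A)
  VRsimplices d r X k =
    filter (λ τ → all? (λ x → all? (λ y → d x y ≤? r) τ) τ)
           (combinations (suc k) X)

  removeAt : List A → ℕ → List A
  removeAt [] i = []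
  removeAt (x ∷ xs) zero = xs
  removeAt (x ∷ xs) (suc i) = x ∷ removeAt xs i

Σ : (k : ℕ) → (Fin k → ℚ) → ℚ
Σ zero f = 0ℚ
Σ (suc k) f = f Fin.zero + Σ k (λ i → f (Fin.suc i))
  where import Data.Fin as Fin

sign : ℕ → ℚ
sign zero = 1ℚ
sign (suc i) = - sign i

module _ {A : Set} (_≟_ : DecidableEquality A) where

  incidence : List A → List A → ℚ
  incidence σ τ = go 0 σ
    where
    go : ℕ → List A → ℚ
    go i [] = 0ℚ
    go i (_ ∷ rest) =
      (if does (ListP.≡-dec _≟_ (removeAt σ i) τ) then sign i else 0ℚ) + go (suc i) rest

  Chain : List (List A) → Set
  Chain S = Fin (length S) → ℚ

  boundary : (Sp Sq : List (List A)) → Chain Sp → Chain Sq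
  boundary Sp Sq c j =
    Σ (length Sp) (λ i → incidence (lookup Sp i) (lookup Sq j) * c i)

  module _ (d : A → A → ℕ) (r : ℕ) (X : List A) where

    Ch : ℕ → Set
    Ch k = Chain (VRsimplices d r X k)

    ∂ : (k : ℕ) → Ch (suc k) → Ch k
    ∂ k = boundary (VRsimplices d r X (suc k)) (VRsimplices d r X k)

    -- z is a p-cycle (∂_0 = 0: unreduced homology)
    IsCycle : (p : ℕ) → Ch p → Set
    IsCycle zero z = ⊤
    IsCycle (suc q) z = ∀ j → ∂ q z j ≡ 0ℚ

    -- rank H_p(VR(X; r); ℚ) ≥ N : there are N p-cycles whose classes are
    -- linearly independent in H_p = Z_p / B_p.
    HomologyRank≥ : (p N : ℕ) → Set
    HomologyRank≥ p N =
      Data.Product.Σ (Fin N → Ch p) λ z →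
        (∀ j → IsCycle p (z j)) Data.Product.×
        (∀ (a : Fin N → ℚ) (b : Ch (suc p)) →
           (∀ i → Σ N (λ j → a j * z j i) ≡ ∂ p b i) →
           ∀ j → a j ≡ 0ℚ)
      where import Data.Product

{-# OPTIONS --safe #-}
-- For a 2n-set S ⊆ [m], two n-subsets of S are at distance 2n when they are complementary in S and at
-- most 2(n − 1) otherwise, so the n-subsets of S span in VR(F_n^[m]; 2(n − 1)) the boundary of a
-- cross-polytope on the ½·C(2n, n) complementary pairs: a p-cycle z_S. To separate the C(m, 2n) cycles in
-- homology, pick in each z_S a facet σ_S (one set from each pair) that is a maximal simplex of the whole
-- complex, because every n-set outside σ_S is disjoint from some member of σ_S, and that for every other
-- 2n-set T has a member not contained in T. Then σ_S has coefficient ±1 in z_S, 0 in each z_T with T ≠ S,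
-- and 0 in every boundary, so a combination of the z_S that is a boundary has all coefficients 0.
-- Such a facet: fix s₁, s₂ ∈ S, split R = S − {s₁, s₂} into halves P and Q, and take the n-subsets A of S
-- that contain s₁ exactly when A ∩ R is P or Q.
module Submission where

open import Defs
open import Data.Bool using (Bool; true; false; not; if_then_else_; _∧_; _∨_; _xor_)
open import Data.Empty using (⊥-elim)
open import Data.Fin as Fin using (Fin)
open import Data.List using (List; []; _∷_; _++_; map; filter; length; lookup)
import Data.List.Properties as ListP
open import Data.List.Membership.Propositional using (_∈_; _∉_)
open import Data.List.Membership.Propositional.Properties
  using (∈-map⁺; ∈-map⁻; ∈-++⁺ˡ; ∈-++⁺ʳ; ∈-++⁻; ∈-filter⁺; ∈-filter⁻; ∈-lookup)
open import Data.List.Relation.Unary.All as All using (All; []; _∷_; all?)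
open import Data.List.Relation.Unary.Any as Any using (here; there)
open import Data.List.Relation.Unary.Unique.Propositional using (Unique; []; _∷_)
open import Data.Nat using (ℕ; zero; suc; _≤_; _<_; _≤?_; z≤n; s≤s)
import Data.Nat.Properties as ℕP
open import Data.Product using (_×_; _,_; ∃; proj₁; proj₂; uncurry)
open import Data.Sum using (_⊎_; inj₁; inj₂)
open import Data.Vec using (Vec; []; _∷_; replicate)
open import Function using (_∘_)
open import Relation.Binary.Definitions using (DecidableEquality)
open import Relation.Binary.PropositionalEquality
open import Relation.Nullary using (¬_; Dec; yes; no; does)
open import Relation.Nullary.Decidable using (dec-true; dec-false; does-⇔)
open import Function.Bundles using (mk⇔)
open import Relation.Unary using (Decidable)

module Homology where

  open import Algebra.Bundles using (CommutativeMonoid)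
  import Data.Fin.Properties as FinP
  import Data.List.Relation.Unary.Any.Properties as AnyP
  open import Data.Rational using (ℚ; 0ℚ; 1ℚ; _+_; _*_; -_; _-_)
  import Data.Rational as ℚ
  import Data.Rational.Properties as ℚP
  open import Data.Unit using (⊤; tt)
  open import Relation.Binary.Core using (Rel)
  open import Relation.Binary.Definitions using (Reflexive; Symmetric)

  open import Algebra.Properties.Group ℚP.+-0-group using () renaming (⁻¹-involutive to neg-involutive)
  open import Algebra.Properties.CommutativeSemigroup
    (CommutativeMonoid.commutativeSemigroup ℚP.+-0-commutativeMonoid) using () renaming (interchange to +-interchange)
  open ≡-Reasoning

  head∉tail : ∀ {A : Set} {x : A} {xs} → Unique (x ∷ xs) → x ∉ xs
  head∉tail (x≢xs ∷ _) x∈xs = All.lookup x≢xs x∈xs refl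

  tail-unique : ∀ {A : Set} {x : A} {xs} → Unique (x ∷ xs) → Unique xs
  tail-unique (_ ∷ u) = u

  listSum : {A : Set} → (A → ℚ) → List A → ℚ
  listSum f [] = 0ℚ
  listSum f (x ∷ xs) = f x + listSum f xs

  module _ {A : Set} where

    Σ-lookup : ∀ (f : A → ℚ) xs → Σ (length xs) (f ∘ lookup xs) ≡ listSum f xs
    Σ-lookup f [] = refl
    Σ-lookup f (x ∷ xs) = cong (f x +_) (Σ-lookup f xs)

    listSum-++ : ∀ (f : A → ℚ) xs ys → listSum f (xs ++ ys) ≡ listSum f xs + listSum f ys
    listSum-++ f [] ys = sym (ℚP.+-identityˡ _)
    listSum-++ f (x ∷ xs) ys = trans (cong (f x +_) (listSum-++ f xs ys)) (sym (ℚP.+-assoc (f x) _ _))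

    listSum-map : ∀ {B : Set} (f : B → ℚ) (g : A → B) xs → listSum f (map g xs) ≡ listSum (f ∘ g) xs
    listSum-map f g [] = refl
    listSum-map f g (x ∷ xs) = cong (f (g x) +_) (listSum-map f g xs)

    listSum-cong : ∀ (f g : A → ℚ) xs → (∀ {x} → x ∈ xs → f x ≡ g x) → listSum f xs ≡ listSum g xs
    listSum-cong f g [] _ = refl
    listSum-cong f g (x ∷ xs) f≗g = cong₂ _+_ (f≗g (here refl)) (listSum-cong f g xs (f≗g ∘ there))

    listSum-zero : ∀ (f : A → ℚ) xs → (∀ {x} → x ∈ xs → f x ≡ 0ℚ) → listSum f xs ≡ 0ℚ
    listSum-zero f [] _ = refl
    listSum-zero f (x ∷ xs) f≗0 =
      trans (cong₂ _+_ (f≗0 (here refl)) (listSum-zero f xs (f≗0 ∘ there))) (ℚP.+-identityʳ 0ℚ)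

    listSum-neg : ∀ (f : A → ℚ) xs → listSum (-_ ∘ f) xs ≡ - listSum f xs
    listSum-neg f [] = refl
    listSum-neg f (x ∷ xs) = trans (cong (- f x +_) (listSum-neg f xs)) (sym (ℚP.neg-distrib-+ (f x) _))

    listSum-filter : ∀ {P : A → Set} (P? : Decidable P) (f : A → ℚ) xs →
      (∀ {x} → x ∈ xs → ¬ P x → f x ≡ 0ℚ) → listSum f (filter P? xs) ≡ listSum f xs
    listSum-filter P? f [] _ = refl
    listSum-filter P? f (x ∷ xs) f≡0 with P? x
    ... | yes _ = cong (f x +_) (listSum-filter P? f xs (f≡0 ∘ there))
    ... | no ¬Px = begin
      listSum f (filter P? xs) ≡⟨ listSum-filter P? f xs (f≡0 ∘ there) ⟩
      listSum f xs             ≡⟨ sym (ℚP.+-identityˡ _) ⟩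
      0ℚ + listSum f xs        ≡⟨ cong (_+ listSum f xs) (sym (f≡0 (here refl) ¬Px)) ⟩
      f x + listSum f xs       ∎

  -- Chains on all faces of a simplex with N vertices, a face being its characteristic vector; the empty
  -- face is included, so ∂ᶠ is the augmented boundary. The recursion is on the first vertex v: if v ∉ w,
  -- a coface of w is either w + v, with incidence +1, or avoids v; if v ∈ w, every coface contains v,
  -- which shifts the position of the added vertex by one and so flips the sign.
  FaceChain : ℕ → Set
  FaceChain N = Vec Bool N → ℚ

  ∂ᶠ : ∀ {N} → FaceChain N → FaceChain N
  ∂ᶠ c [] = 0ℚ
  ∂ᶠ c (false ∷ w) = ∂ᶠ (c ∘ (false ∷_)) w + c (true ∷ w)
  ∂ᶠ c (true ∷ w) = - ∂ᶠ (c ∘ (true ∷_)) w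

  ∂ᶠ-cong : ∀ {N} (c c′ : FaceChain N) → (∀ v → c v ≡ c′ v) → ∀ w → ∂ᶠ c w ≡ ∂ᶠ c′ w
  ∂ᶠ-cong c c′ c≗c′ [] = refl
  ∂ᶠ-cong c c′ c≗c′ (false ∷ w) =
    cong₂ _+_ (∂ᶠ-cong _ _ (c≗c′ ∘ (false ∷_)) w) (c≗c′ (true ∷ w))
  ∂ᶠ-cong c c′ c≗c′ (true ∷ w) = cong -_ (∂ᶠ-cong _ _ (c≗c′ ∘ (true ∷_)) w)

  ∂ᶠ-+ : ∀ {N} (c c′ : FaceChain N) w → ∂ᶠ (λ v → c v + c′ v) w ≡ ∂ᶠ c w + ∂ᶠ c′ w
  ∂ᶠ-+ c c′ [] = refl
  ∂ᶠ-+ c c′ (false ∷ w) =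
    trans (cong (_+ (c (true ∷ w) + c′ (true ∷ w))) (∂ᶠ-+ (c ∘ (false ∷_)) (c′ ∘ (false ∷_)) w))
          (+-interchange (∂ᶠ (c ∘ (false ∷_)) w) (∂ᶠ (c′ ∘ (false ∷_)) w) (c (true ∷ w)) (c′ (true ∷ w)))
  ∂ᶠ-+ c c′ (true ∷ w) =
    trans (cong -_ (∂ᶠ-+ (c ∘ (true ∷_)) (c′ ∘ (true ∷_)) w))
          (ℚP.neg-distrib-+ (∂ᶠ (c ∘ (true ∷_)) w) (∂ᶠ (c′ ∘ (true ∷_)) w))

  ∂ᶠ-neg : ∀ {N} (c : FaceChain N) w → ∂ᶠ (-_ ∘ c) w ≡ - ∂ᶠ c w
  ∂ᶠ-neg c [] = refl
  ∂ᶠ-neg c (false ∷ w) =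
    trans (cong (_+ (- c (true ∷ w))) (∂ᶠ-neg (c ∘ (false ∷_)) w))
          (sym (ℚP.neg-distrib-+ (∂ᶠ (c ∘ (false ∷_)) w) (c (true ∷ w))))
  ∂ᶠ-neg c (true ∷ w) = cong -_ (∂ᶠ-neg (c ∘ (true ∷_)) w)

  ∂ᶠ-zero : ∀ {N} (c : FaceChain N) → (∀ v → c v ≡ 0ℚ) → ∀ w → ∂ᶠ c w ≡ 0ℚ
  ∂ᶠ-zero c c≗0 [] = refl
  ∂ᶠ-zero c c≗0 (false ∷ w) =
    trans (cong₂ _+_ (∂ᶠ-zero _ (c≗0 ∘ (false ∷_)) w) (c≗0 (true ∷ w))) (ℚP.+-identityʳ 0ℚ)
  ∂ᶠ-zero c c≗0 (true ∷ w) = cong -_ (∂ᶠ-zero _ (c≗0 ∘ (true ∷_)) w)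

  emptySimplex : ∀ {N} → FaceChain N
  emptySimplex [] = 1ℚ
  emptySimplex (true ∷ v) = 0ℚ
  emptySimplex (false ∷ v) = emptySimplex v

  ∂ᶠ-emptySimplex : ∀ {N} (w : Vec Bool N) → ∂ᶠ emptySimplex w ≡ 0ℚ
  ∂ᶠ-emptySimplex [] = refl
  ∂ᶠ-emptySimplex (false ∷ w) = trans (ℚP.+-identityʳ _) (∂ᶠ-emptySimplex w)
  ∂ᶠ-emptySimplex (true ∷ w) = cong -_ (∂ᶠ-zero (λ _ → 0ℚ) (λ _ → refl) w)

  emptySimplex-card : ∀ {N} (v : Vec Bool N) → emptySimplex v ≢ 0ℚ → card v ≡ 0
  emptySimplex-card [] _ = refl
  emptySimplex-card (true ∷ v) ≢0 = ⊥-elim (≢0 refl)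
  emptySimplex-card (false ∷ v) ≢0 = emptySimplex-card v ≢0

  module Incidence {A : Set} (_≟_ : DecidableEquality A) where

    _≟ₗ_ : DecidableEquality (List A)
    _≟ₗ_ = ListP.≡-dec _≟_

    incidenceTerm : List A → List A → ℕ → ℚ
    incidenceTerm σ τ i = if does (removeAt σ i ≟ₗ τ) then sign i else 0ℚ

    -- `incidence` is a sum computed by a local function; unification names that function here, the
    -- with-abstractions putting its defining equation in pattern form.
    mutual
      incidenceFrom : List A → List A → ℕ → List A → ℚ
      incidenceFrom = _

      incidence-∷ : ∀ x σ τ →
        incidence _≟_ (x ∷ σ) τ ≡ incidenceTerm (x ∷ σ) τ 0 + incidenceFrom (x ∷ σ) τ 1 σ
      incidence-∷ x σ τ with incidenceTerm (x ∷ σ) τ 0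
      ... | t with x ∷ σ
      ... | s with 1
      ... | w = refl

    kronecker : List A → List A → ℚ
    kronecker τ ρ = if does (τ ≟ₗ ρ) then 1ℚ else 0ℚ

    kronecker-≢ : ∀ {τ ρ} → τ ≢ ρ → kronecker τ ρ ≡ 0ℚ
    kronecker-≢ {τ} {ρ} τ≢ρ = cong (λ b → if b then 1ℚ else 0ℚ) (dec-false (τ ≟ₗ ρ) τ≢ρ)

    kronecker-refl : ∀ τ → kronecker τ τ ≡ 1ℚ
    kronecker-refl τ = cong (λ b → if b then 1ℚ else 0ℚ) (dec-true (τ ≟ₗ τ) refl)

    does-∷ : ∀ x (τ ρ : List A) → does ((x ∷ τ) ≟ₗ (x ∷ ρ)) ≡ does (τ ≟ₗ ρ)
    does-∷ x τ ρ = does-⇔ (mk⇔ ListP.∷-injectiveʳ (cong (x ∷_))) ((x ∷ τ) ≟ₗ (x ∷ ρ)) (τ ≟ₗ ρ)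

    kronecker-∷ : ∀ (x : A) τ ρ → kronecker (x ∷ τ) (x ∷ ρ) ≡ kronecker τ ρ
    kronecker-∷ x τ ρ = cong (λ b → if b then 1ℚ else 0ℚ) (does-∷ x τ ρ)

    removeAt-⊆ : ∀ {y : A} σ i → y ∈ removeAt σ i → y ∈ σ
    removeAt-⊆ (x ∷ σ) zero y∈ = there y∈
    removeAt-⊆ (x ∷ σ) (suc i) (here y≡x) = here y≡x
    removeAt-⊆ (x ∷ σ) (suc i) (there y∈) = there (removeAt-⊆ σ i y∈)

    incidenceTerm-≢ : ∀ σ τ i → removeAt σ i ≢ τ → incidenceTerm σ τ i ≡ 0ℚ
    incidenceTerm-≢ σ τ i σ∖i≢τ = cong (λ b → if b then sign i else 0ℚ) (dec-false (removeAt σ i ≟ₗ τ) σ∖i≢τ)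

    incidenceFrom-≢ : ∀ σ τ k ρ → (∀ i → k ≤ i → removeAt σ i ≢ τ) → incidenceFrom σ τ k ρ ≡ 0ℚ
    incidenceFrom-≢ σ τ k [] _ = refl
    incidenceFrom-≢ σ τ k (_ ∷ ρ) noFace = begin
      incidenceTerm σ τ k + incidenceFrom σ τ (suc k) ρ
        ≡⟨ cong₂ _+_ (incidenceTerm-≢ σ τ k (noFace k ℕP.≤-refl))
                     (incidenceFrom-≢ σ τ (suc k) ρ (λ i k<i → noFace i (ℕP.<⇒≤ k<i))) ⟩
      0ℚ + 0ℚ ≡⟨ ℚP.+-identityʳ 0ℚ ⟩
      0ℚ ∎

    incidence-≢ : ∀ σ τ → (∀ i → removeAt σ i ≢ τ) → incidence _≟_ σ τ ≡ 0ℚ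
    incidence-≢ [] τ _ = refl
    incidence-≢ (x ∷ σ) τ noFace = begin
      incidence _≟_ (x ∷ σ) τ ≡⟨ incidence-∷ x σ τ ⟩
      incidenceTerm (x ∷ σ) τ 0 + incidenceFrom (x ∷ σ) τ 1 σ
        ≡⟨ cong₂ _+_ (incidenceTerm-≢ (x ∷ σ) τ 0 (noFace 0))
                     (incidenceFrom-≢ (x ∷ σ) τ 1 σ (λ i _ → noFace i)) ⟩
      0ℚ + 0ℚ ≡⟨ ℚP.+-identityʳ 0ℚ ⟩
      0ℚ ∎

    incidence-∉ : ∀ σ τ {x : A} → x ∈ τ → x ∉ σ → incidence _≟_ σ τ ≡ 0ℚ
    incidence-∉ σ τ x∈τ x∉σ =
      incidence-≢ σ τ (λ i σ∖i≡τ → x∉σ (removeAt-⊆ σ i (subst (_ ∈_) (sym σ∖i≡τ) x∈τ)))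

    incidenceFrom-∷ : ∀ (x : A) τ ρ k σ → incidenceFrom (x ∷ τ) (x ∷ ρ) (suc k) σ ≡ - incidenceFrom τ ρ k σ
    incidenceFrom-∷ x τ ρ k [] = refl
    incidenceFrom-∷ x τ ρ k (_ ∷ σ) = begin
      incidenceTerm (x ∷ τ) (x ∷ ρ) (suc k) + incidenceFrom (x ∷ τ) (x ∷ ρ) (suc (suc k)) σ
        ≡⟨ cong₂ _+_ shiftedTerm (incidenceFrom-∷ x τ ρ (suc k) σ) ⟩
      - incidenceTerm τ ρ k + - incidenceFrom τ ρ (suc k) σ
        ≡⟨ sym (ℚP.neg-distrib-+ (incidenceTerm τ ρ k) (incidenceFrom τ ρ (suc k) σ)) ⟩
      - (incidenceTerm τ ρ k + incidenceFrom τ ρ (suc k) σ) ∎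
      where
      if-neg : ∀ (b : Bool) q → (if b then - q else 0ℚ) ≡ - (if b then q else 0ℚ)
      if-neg true q = refl
      if-neg false q = refl
      shiftedTerm : incidenceTerm (x ∷ τ) (x ∷ ρ) (suc k) ≡ - incidenceTerm τ ρ k
      shiftedTerm = trans (cong (λ b → if b then sign (suc k) else 0ℚ) (does-∷ x (removeAt τ k) ρ))
                          (if-neg (does (removeAt τ k ≟ₗ ρ)) (sign k))

    incidence-∷-∷ : ∀ (x : A) τ ρ → x ∉ τ → incidence _≟_ (x ∷ τ) (x ∷ ρ) ≡ - incidence _≟_ τ ρ
    incidence-∷-∷ x τ ρ x∉τ = begin
      incidence _≟_ (x ∷ τ) (x ∷ ρ) ≡⟨ incidence-∷ x τ (x ∷ ρ) ⟩
      incidenceTerm (x ∷ τ) (x ∷ ρ) 0 + incidenceFrom (x ∷ τ) (x ∷ ρ) 1 τ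
        ≡⟨ cong₂ _+_ (incidenceTerm-≢ (x ∷ τ) (x ∷ ρ) 0 (λ τ≡x∷ρ → x∉τ (subst (x ∈_) (sym τ≡x∷ρ) (here refl))))
                     (incidenceFrom-∷ x τ ρ 0 τ) ⟩
      0ℚ + - incidenceFrom τ ρ 0 τ ≡⟨ ℚP.+-identityˡ _ ⟩
      - incidence _≟_ τ ρ ∎

    incidence-∷-∉ : ∀ (x : A) τ ρ → x ∉ ρ → incidence _≟_ (x ∷ τ) ρ ≡ kronecker τ ρ
    incidence-∷-∉ x τ ρ x∉ρ = begin
      incidence _≟_ (x ∷ τ) ρ ≡⟨ incidence-∷ x τ ρ ⟩
      kronecker τ ρ + incidenceFrom (x ∷ τ) ρ 1 τ
        ≡⟨ cong (kronecker τ ρ +_) (incidenceFrom-≢ (x ∷ τ) ρ 1 τ keepsX) ⟩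
      kronecker τ ρ + 0ℚ ≡⟨ ℚP.+-identityʳ _ ⟩
      kronecker τ ρ ∎
      where
      keepsX : ∀ i → 1 ≤ i → removeAt (x ∷ τ) i ≢ ρ
      keepsX (suc i) _ x∷τ∖i≡ρ = x∉ρ (subst (x ∈_) x∷τ∖i≡ρ (here refl))

  module Faces {A : Set} (_≟_ : DecidableEquality A) where

    open Incidence _≟_
    open import Data.List.Membership.DecPropositional _≟_ using (_∈?_)

    select : (X : List A) → Vec Bool (length X) → List A
    select [] [] = []
    select (x ∷ X) (true ∷ v) = x ∷ select X v
    select (x ∷ X) (false ∷ v) = select X v

    select-⊆ : ∀ X v {y} → y ∈ select X v → y ∈ X
    select-⊆ [] [] ()
    select-⊆ (x ∷ X) (true ∷ v) (here y≡x) = here y≡x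
    select-⊆ (x ∷ X) (true ∷ v) (there y∈) = there (select-⊆ X v y∈)
    select-⊆ (x ∷ X) (false ∷ v) y∈ = there (select-⊆ X v y∈)

    select-empty : ∀ X v → card v ≡ 0 → select X v ≡ []
    select-empty [] [] _ = refl
    select-empty (x ∷ X) (false ∷ v) ∣v∣≡0 = select-empty X v ∣v∣≡0

    length-select : ∀ X v → length (select X v) ≡ card v
    length-select [] [] = refl
    length-select (x ∷ X) (true ∷ v) = cong suc (length-select X v)
    length-select (x ∷ X) (false ∷ v) = length-select X v

    select-unique : ∀ X → Unique X → ∀ v → Unique (select X v)
    select-unique [] _ [] = []
    select-unique (x ∷ X) uX (true ∷ v) =
      All.tabulate (λ y∈ x≡y → head∉tail uX (subst (_∈ X) (sym x≡y) (select-⊆ X v y∈)))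
        ∷ select-unique X (tail-unique uX) v
    select-unique (x ∷ X) uX (false ∷ v) = select-unique X (tail-unique uX) v

    select∈combinations : ∀ X v → select X v ∈ combinations (card v) X
    select∈combinations [] [] = here refl
    select∈combinations (x ∷ X) (true ∷ v) = ∈-++⁺ˡ (∈-map⁺ (x ∷_) (select∈combinations X v))
    select∈combinations (x ∷ X) (false ∷ v) with card v in ∣v∣
    ... | zero = here (select-empty X v ∣v∣)
    ... | suc k = ∈-++⁺ʳ _ (subst (λ k → select X v ∈ combinations k X) ∣v∣ (select∈combinations X v))

    combinations⇒select : ∀ X k {τ} → τ ∈ combinations k X →
                          ∃ λ (v : Vec Bool (length X)) → card v ≡ k × τ ≡ select X v
    combinations⇒select X zero (here refl) = replicate _ false , allFalse X
      where
      allFalse : ∀ X → card (replicate (length X) false) ≡ 0 × [] ≡ select X (replicate (length X) false)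
      allFalse [] = refl , refl
      allFalse (x ∷ X) = allFalse X
    combinations⇒select (x ∷ X) (suc k) τ∈ with ∈-++⁻ (map (x ∷_) (combinations k X)) τ∈
    ... | inj₁ τ∈x∷ with ∈-map⁻ (x ∷_) τ∈x∷
    ...   | τ′ , τ′∈ , refl with combinations⇒select X k τ′∈
    ...     | v , ∣v∣ , refl = true ∷ v , cong suc ∣v∣ , refl
    combinations⇒select (x ∷ X) (suc k) τ∈ | inj₂ τ∈′ with combinations⇒select X (suc k) τ∈′
    ... | v , ∣v∣ , refl = false ∷ v , ∣v∣ , refl

    combinations-⊆ : ∀ X k {τ y} → τ ∈ combinations k X → y ∈ τ → y ∈ X
    combinations-⊆ X k τ∈ y∈τ with combinations⇒select X k τ∈
    ... | v , _ , refl = select-⊆ X v y∈τ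

    charVec : (X : List A) → (A → Bool) → Vec Bool (length X)
    charVec [] P = []
    charVec (x ∷ X) P = P x ∷ charVec X P

    charVec-cong : ∀ X (P Q : A → Bool) → (∀ {y} → y ∈ X → P y ≡ Q y) → charVec X P ≡ charVec X Q
    charVec-cong [] P Q _ = refl
    charVec-cong (x ∷ X) P Q P≗Q = cong₂ _∷_ (P≗Q (here refl)) (charVec-cong X P Q (P≗Q ∘ there))

    select-charVec⁺ : ∀ X P {y} → y ∈ X → P y ≡ true → y ∈ select X (charVec X P)
    select-charVec⁺ (x ∷ X) P (here refl) Py rewrite Py = here refl
    select-charVec⁺ (x ∷ X) P (there y∈) Py with P x
    ... | true = there (select-charVec⁺ X P y∈ Py)
    ... | false = select-charVec⁺ X P y∈ Py

    select-charVec⁻ : ∀ X P {y} → y ∈ select X (charVec X P) → P y ≡ true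
    select-charVec⁻ (x ∷ X) P y∈ with P x in Px
    select-charVec⁻ (x ∷ X) P (here refl) | true = Px
    select-charVec⁻ (x ∷ X) P (there y∈) | true = select-charVec⁻ X P y∈
    select-charVec⁻ (x ∷ X) P y∈ | false = select-charVec⁻ X P y∈

    _∈ᵇ_ : A → List A → Bool
    y ∈ᵇ σ = does (y ∈? σ)

    faceVec : (X : List A) → List A → Vec Bool (length X)
    faceVec X σ = charVec X (_∈ᵇ σ)

    faceVec-select : ∀ X → Unique X → ∀ v → faceVec X (select X v) ≡ v
    faceVec-select [] _ [] = refl
    faceVec-select (x ∷ X) uX (true ∷ v) =
      cong₂ _∷_ (dec-true (x ∈? (x ∷ select X v)) (here refl)) (trans tail≡ (faceVec-select X (tail-unique uX) v))
      where
      dropHead : ∀ {y} → y ∈ X → y ∈ x ∷ select X v → y ∈ select X v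
      dropHead y∈X (here refl) = ⊥-elim (head∉tail uX y∈X)
      dropHead y∈X (there y∈) = y∈
      tail≡ : charVec X (_∈ᵇ (x ∷ select X v)) ≡ faceVec X (select X v)
      tail≡ = charVec-cong X _ _ λ {y} y∈X →
        does-⇔ (mk⇔ (dropHead y∈X) there) (y ∈? (x ∷ select X v)) (y ∈? select X v)
    faceVec-select (x ∷ X) uX (false ∷ v) =
      cong₂ _∷_ (dec-false (x ∈? _) (head∉tail uX ∘ select-⊆ X v)) (faceVec-select X (tail-unique uX) v)

    listSum-combinations-∷ : ∀ x X k (g : List A → ℚ) → listSum g (combinations (suc k) (x ∷ X)) ≡
      listSum (g ∘ (x ∷_)) (combinations k X) + listSum g (combinations (suc k) X)
    listSum-combinations-∷ x X k g =
      trans (listSum-++ g (map (x ∷_) (combinations k X)) (combinations (suc k) X))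
            (cong (_+ listSum g (combinations (suc k) X)) (listSum-map g (x ∷_) (combinations k X)))

    kronecker-sum : ∀ X → Unique X → ∀ w (h : List A → ℚ) →
      listSum (λ τ → kronecker τ (select X w) * h τ) (combinations (card w) X) ≡ h (select X w)
    kronecker-sum [] _ [] h = begin
      kronecker [] [] * h [] + 0ℚ ≡⟨ ℚP.+-identityʳ _ ⟩
      kronecker [] [] * h []      ≡⟨ cong (_* h []) (kronecker-refl []) ⟩
      1ℚ * h []                   ≡⟨ ℚP.*-identityˡ (h []) ⟩
      h []                        ∎
    kronecker-sum (x ∷ X) uX (true ∷ w) h = begin
      listSum term (combinations (suc (card w)) (x ∷ X))
        ≡⟨ listSum-combinations-∷ x X (card w) term ⟩
      listSum (term ∘ (x ∷_)) (combinations (card w) X) + listSum term (combinations (suc (card w)) X)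
        ≡⟨ cong₂ _+_ (trans (listSum-cong (term ∘ (x ∷_)) (λ τ → kronecker τ (select X w) * h (x ∷ τ))
                                          (combinations (card w) X)
                                          (λ {τ} _ → cong (_* h (x ∷ τ)) (kronecker-∷ x τ (select X w))))
                            (kronecker-sum X (tail-unique uX) w (h ∘ (x ∷_))))
                     (listSum-zero term (combinations (suc (card w)) X)
                                   (λ {τ} τ∈ → trans (cong (_* h τ) (kronecker-≢ (x∉ τ∈))) (ℚP.*-zeroˡ (h τ)))) ⟩
      h (x ∷ select X w) + 0ℚ
        ≡⟨ ℚP.+-identityʳ _ ⟩
      h (x ∷ select X w) ∎
      where
      term = λ τ → kronecker τ (x ∷ select X w) * h τ
      x∉ : ∀ {τ} → τ ∈ combinations (suc (card w)) X → τ ≢ x ∷ select X w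
      x∉ τ∈ refl = head∉tail uX (combinations-⊆ X (suc (card w)) τ∈ (here refl))
    kronecker-sum (x ∷ X) uX (false ∷ w) h with card w in ∣w∣
    ... | zero rewrite select-empty X w ∣w∣ = kronecker-sum [] [] [] h
    ... | suc k = begin
      listSum term (combinations (suc k) (x ∷ X))
        ≡⟨ listSum-combinations-∷ x X k term ⟩
      listSum (term ∘ (x ∷_)) (combinations k X) + listSum term (combinations (suc k) X)
        ≡⟨ cong₂ _+_ (listSum-zero (term ∘ (x ∷_)) (combinations k X)
                                   (λ {τ} _ → trans (cong (_* h (x ∷ τ)) (kronecker-≢ x∉)) (ℚP.*-zeroˡ (h (x ∷ τ)))))
                     (subst (λ k → listSum term (combinations k X) ≡ h (select X w)) ∣w∣
                            (kronecker-sum X (tail-unique uX) w h)) ⟩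
      0ℚ + h (select X w)
        ≡⟨ ℚP.+-identityˡ _ ⟩
      h (select X w) ∎
      where
      term = λ τ → kronecker τ (select X w) * h τ
      x∉ : ∀ {τ} → x ∷ τ ≢ select X w
      x∉ x∷τ≡ = head∉tail uX (select-⊆ X w (subst (x ∈_) x∷τ≡ (here refl)))

    listSum-incidence : ∀ X → Unique X → ∀ w (f : List A → ℚ) →
      listSum (λ σ → incidence _≟_ σ (select X w) * f σ) (combinations (suc (card w)) X) ≡ ∂ᶠ (f ∘ select X) w
    listSum-incidence [] _ [] f = refl
    listSum-incidence (x ∷ X) uX (true ∷ w) f = begin
      listSum term (combinations (suc (suc (card w))) (x ∷ X))
        ≡⟨ listSum-combinations-∷ x X (suc (card w)) term ⟩
      listSum (term ∘ (x ∷_)) (combinations (suc (card w)) X) + listSum term (combinations (suc (suc (card w))) X)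
        ≡⟨ cong₂ _+_ withX (listSum-zero term (combinations (suc (suc (card w))) X)
                             (λ {σ} σ∈ → trans (cong (_* f σ) (incidence-∉ σ (x ∷ select X w) (here refl)
                                                                                          (x∉ (suc (suc (card w))) σ∈)))
                                               (ℚP.*-zeroˡ (f σ)))) ⟩
      - ∂ᶠ (f ∘ (x ∷_) ∘ select X) w + 0ℚ
        ≡⟨ ℚP.+-identityʳ _ ⟩
      - ∂ᶠ (f ∘ (x ∷_) ∘ select X) w ∎
      where
      term = λ σ → incidence _≟_ σ (x ∷ select X w) * f σ
      x∉ : ∀ k {σ} → σ ∈ combinations k X → x ∉ σ
      x∉ k σ∈ = head∉tail uX ∘ combinations-⊆ X k σ∈
      g = λ τ → incidence _≟_ τ (select X w) * f (x ∷ τ)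
      withX : listSum (term ∘ (x ∷_)) (combinations (suc (card w)) X) ≡ - ∂ᶠ (f ∘ (x ∷_) ∘ select X) w
      withX = begin
        listSum (term ∘ (x ∷_)) (combinations (suc (card w)) X)
          ≡⟨ listSum-cong (term ∘ (x ∷_)) (-_ ∘ g) (combinations (suc (card w)) X)
               (λ {τ} τ∈ → trans (cong (_* f (x ∷ τ)) (incidence-∷-∷ x τ (select X w) (x∉ (suc (card w)) τ∈)))
                                 (sym (ℚP.neg-distribˡ-* (incidence _≟_ τ (select X w)) (f (x ∷ τ))))) ⟩
        listSum (-_ ∘ g) (combinations (suc (card w)) X)
          ≡⟨ listSum-neg g (combinations (suc (card w)) X) ⟩
        - listSum g (combinations (suc (card w)) X)
          ≡⟨ cong -_ (listSum-incidence X (tail-unique uX) w (f ∘ (x ∷_))) ⟩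
        - ∂ᶠ (f ∘ (x ∷_) ∘ select X) w ∎
    listSum-incidence (x ∷ X) uX (false ∷ w) f = begin
      listSum term (combinations (suc (card w)) (x ∷ X))
        ≡⟨ listSum-combinations-∷ x X (card w) term ⟩
      listSum (term ∘ (x ∷_)) (combinations (card w) X) + listSum term (combinations (suc (card w)) X)
        ≡⟨ cong₂ _+_ withX (listSum-incidence X (tail-unique uX) w f) ⟩
      f (x ∷ select X w) + ∂ᶠ (f ∘ select X) w
        ≡⟨ ℚP.+-comm (f (x ∷ select X w)) (∂ᶠ (f ∘ select X) w) ⟩
      ∂ᶠ (f ∘ select X) w + f (x ∷ select X w) ∎
      where
      term = λ σ → incidence _≟_ σ (select X w) * f σ
      withX : listSum (term ∘ (x ∷_)) (combinations (card w) X) ≡ f (x ∷ select X w)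
      withX = trans (listSum-cong (term ∘ (x ∷_)) (λ τ → kronecker τ (select X w) * f (x ∷ τ))
                                  (combinations (card w) X)
                                  (λ {τ} _ → cong (_* f (x ∷ τ))
                                                  (incidence-∷-∉ x τ (select X w) (head∉tail uX ∘ select-⊆ X w))))
                    (kronecker-sum X (tail-unique uX) w (f ∘ (x ∷_)))

    emptySimplex-∈ : ∀ X v {y : A} → y ∈ select X v → emptySimplex v ≡ 0ℚ
    emptySimplex-∈ [] [] ()
    emptySimplex-∈ (x ∷ X) (true ∷ v) _ = refl
    emptySimplex-∈ (x ∷ X) (false ∷ v) y∈ = emptySimplex-∈ X v y∈

    emptySimplex-∉ : ∀ X v → (∀ {y : A} → y ∉ select X v) → emptySimplex v ≡ 1ℚ
    emptySimplex-∉ [] [] _ = refl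
    emptySimplex-∉ (x ∷ X) (true ∷ v) noVertex = ⊥-elim (noVertex (here refl))
    emptySimplex-∉ (x ∷ X) (false ∷ v) noVertex = emptySimplex-∉ X v noVertex

  module Cone {A : Set} (_≟_ : DecidableEquality A) where

    open Faces _≟_
    open import Data.List.Membership.DecPropositional _≟_ using (_∈?_)

    -- The join a * c: on a face containing a it is ± c (face without a), the sign counting the vertices
    -- of the face that precede a in X.
    cone : (X : List A) → A → FaceChain (length X) → FaceChain (length X)
    cone [] a c [] = 0ℚ
    cone (x ∷ X) a c (true ∷ v) = if does (x ≟ a) then c (false ∷ v) else - cone X a (c ∘ (true ∷_)) v
    cone (x ∷ X) a c (false ∷ v) = if does (x ≟ a) then 0ℚ else cone X a (c ∘ (false ∷_)) v

    cone-+ : ∀ X a (c c′ : FaceChain (length X)) w → cone X a (λ v → c v + c′ v) w ≡ cone X a c w + cone X a c′ w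
    cone-+ [] a c c′ [] = refl
    cone-+ (x ∷ X) a c c′ (true ∷ w) with x ≟ a
    ... | yes _ = refl
    ... | no _ = trans (cong -_ (cone-+ X a (c ∘ (true ∷_)) (c′ ∘ (true ∷_)) w))
                       (ℚP.neg-distrib-+ (cone X a (c ∘ (true ∷_)) w) (cone X a (c′ ∘ (true ∷_)) w))
    cone-+ (x ∷ X) a c c′ (false ∷ w) with x ≟ a
    ... | yes _ = refl
    ... | no _ = cone-+ X a (c ∘ (false ∷_)) (c′ ∘ (false ∷_)) w

    cone-neg : ∀ X a (c : FaceChain (length X)) w → cone X a (-_ ∘ c) w ≡ - cone X a c w
    cone-neg [] a c [] = refl
    cone-neg (x ∷ X) a c (true ∷ w) with x ≟ a
    ... | yes _ = refl
    ... | no _ = cong -_ (cone-neg X a (c ∘ (true ∷_)) w)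
    cone-neg (x ∷ X) a c (false ∷ w) with x ≟ a
    ... | yes _ = refl
    ... | no _ = cone-neg X a (c ∘ (false ∷_)) w

    cone-zero : ∀ X a (c : FaceChain (length X)) → (∀ v → c v ≡ 0ℚ) → ∀ w → cone X a c w ≡ 0ℚ
    cone-zero [] a c _ [] = refl
    cone-zero (x ∷ X) a c c≡0 (true ∷ w) with x ≟ a
    ... | yes _ = c≡0 (false ∷ w)
    ... | no _ = cong -_ (cone-zero X a (c ∘ (true ∷_)) (c≡0 ∘ (true ∷_)) w)
    cone-zero (x ∷ X) a c c≡0 (false ∷ w) with x ≟ a
    ... | yes _ = refl
    ... | no _ = cone-zero X a (c ∘ (false ∷_)) (c≡0 ∘ (false ∷_)) w

    ∈-∷-≢ : ∀ {a x : A} {X} → a ∈ x ∷ X → x ≢ a → a ∈ X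
    ∈-∷-≢ (here a≡x) x≢a = ⊥-elim (x≢a (sym a≡x))
    ∈-∷-≢ (there a∈X) _ = a∈X

    cone-boundary : ∀ X a (c : FaceChain (length X)) → a ∈ X → (∀ v → a ∈ select X v → c v ≡ 0ℚ) →
                    ∀ w → ∂ᶠ (cone X a c) w ≡ c w - cone X a (∂ᶠ c) w
    cone-boundary (x ∷ X) a c a∈ c≡0 (false ∷ w) with x ≟ a
    ... | yes refl = begin
      ∂ᶠ (λ _ → 0ℚ) w + c (false ∷ w) ≡⟨ cong (_+ c (false ∷ w)) (∂ᶠ-zero (λ _ → 0ℚ) (λ _ → refl) w) ⟩
      0ℚ + c (false ∷ w)              ≡⟨ ℚP.+-identityˡ _ ⟩
      c (false ∷ w)                   ≡⟨ sym (ℚP.+-identityʳ _) ⟩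
      c (false ∷ w) - 0ℚ              ∎
    ... | no x≢a = begin
      ∂ᶠ (cone X a c₀) w - cone X a c₁ w
        ≡⟨ cong (_- cone X a c₁ w) (cone-boundary X a c₀ (∈-∷-≢ a∈ x≢a) (c≡0 ∘ (false ∷_)) w) ⟩
      (c₀ w - cone X a (∂ᶠ c₀) w) - cone X a c₁ w
        ≡⟨ ℚP.+-assoc (c₀ w) (- cone X a (∂ᶠ c₀) w) (- cone X a c₁ w) ⟩
      c₀ w + (- cone X a (∂ᶠ c₀) w - cone X a c₁ w)
        ≡⟨ cong (c₀ w +_) (sym (ℚP.neg-distrib-+ (cone X a (∂ᶠ c₀) w) (cone X a c₁ w))) ⟩
      c₀ w - (cone X a (∂ᶠ c₀) w + cone X a c₁ w)
        ≡⟨ cong (_-_ (c₀ w)) (sym (cone-+ X a (∂ᶠ c₀) c₁ w)) ⟩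
      c₀ w - cone X a (λ v → ∂ᶠ c₀ v + c₁ v) w ∎
      where
      c₀ = c ∘ (false ∷_)
      c₁ = c ∘ (true ∷_)
    cone-boundary (x ∷ X) a c a∈ c≡0 (true ∷ w) with x ≟ a
    ... | yes refl = sym (begin
      c (true ∷ w) - (∂ᶠ c₀ w + c (true ∷ w))
        ≡⟨ cong (λ q → q - (∂ᶠ c₀ w + q)) (c≡0 (true ∷ w) (here refl)) ⟩
      0ℚ - (∂ᶠ c₀ w + 0ℚ) ≡⟨ ℚP.+-identityˡ _ ⟩
      - (∂ᶠ c₀ w + 0ℚ)    ≡⟨ cong -_ (ℚP.+-identityʳ _) ⟩
      - ∂ᶠ c₀ w           ∎)
      where
      c₀ = c ∘ (false ∷_)
    ... | no x≢a = begin
      - ∂ᶠ (-_ ∘ cone X a c₁) w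
        ≡⟨ cong -_ (∂ᶠ-neg (cone X a c₁) w) ⟩
      - - ∂ᶠ (cone X a c₁) w
        ≡⟨ neg-involutive _ ⟩
      ∂ᶠ (cone X a c₁) w
        ≡⟨ cone-boundary X a c₁ (∈-∷-≢ a∈ x≢a) (λ v a∈v → c≡0 (true ∷ v) (there a∈v)) w ⟩
      c₁ w - cone X a (∂ᶠ c₁) w
        ≡⟨ cong (_-_ (c₁ w)) (sym (trans (cong -_ (cone-neg X a (∂ᶠ c₁) w)) (neg-involutive _))) ⟩
      c₁ w - - cone X a (-_ ∘ ∂ᶠ c₁) w ∎
      where
      c₁ = c ∘ (true ∷_)

    dropVertex : (X : List A) → A → Vec Bool (length X) → Vec Bool (length X)
    dropVertex [] a [] = []
    dropVertex (x ∷ X) a (b ∷ v) = if does (x ≟ a) then false ∷ v else b ∷ dropVertex X a v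

    cone-∉ : ∀ X a (c : FaceChain (length X)) v → a ∉ select X v → cone X a c v ≡ 0ℚ
    cone-∉ [] a c [] _ = refl
    cone-∉ (x ∷ X) a c (true ∷ v) a∉ with x ≟ a
    ... | yes refl = ⊥-elim (a∉ (here refl))
    ... | no _ = cong -_ (cone-∉ X a (c ∘ (true ∷_)) v (a∉ ∘ there))
    cone-∉ (x ∷ X) a c (false ∷ v) a∉ with x ≟ a
    ... | yes _ = refl
    ... | no _ = cone-∉ X a (c ∘ (false ∷_)) v a∉

    cone-∈ : ∀ X → Unique X → ∀ a (c : FaceChain (length X)) v → a ∈ select X v →
             cone X a c v ≡ c (dropVertex X a v) ⊎ cone X a c v ≡ - c (dropVertex X a v)
    cone-∈ [] _ a c [] ()
    cone-∈ (x ∷ X) uX a c (true ∷ v) a∈ with x ≟ a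
    ... | yes refl = inj₁ refl
    ... | no x≢a with cone-∈ X (tail-unique uX) a (c ∘ (true ∷_)) v (∈-∷-≢ a∈ x≢a)
    ...   | inj₁ e = inj₂ (cong -_ e)
    ...   | inj₂ e = inj₁ (trans (cong -_ e) (neg-involutive _))
    cone-∈ (x ∷ X) uX a c (false ∷ v) a∈ with x ≟ a
    ... | yes refl = ⊥-elim (head∉tail uX (select-⊆ X v a∈))
    ... | no _ = cone-∈ X (tail-unique uX) a (c ∘ (false ∷_)) v a∈

    select-dropVertex⁺ : ∀ X a v {y} → y ∈ select X v → y ≢ a → y ∈ select X (dropVertex X a v)
    select-dropVertex⁺ [] a [] () _
    select-dropVertex⁺ (x ∷ X) a (b ∷ v) y∈ y≢a with x ≟ a
    select-dropVertex⁺ (x ∷ X) a (true ∷ v) (here refl) y≢a | yes refl = ⊥-elim (y≢a refl)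
    select-dropVertex⁺ (x ∷ X) a (true ∷ v) (there y∈) y≢a | yes refl = y∈
    select-dropVertex⁺ (x ∷ X) a (false ∷ v) y∈ y≢a | yes refl = y∈
    select-dropVertex⁺ (x ∷ X) a (true ∷ v) (here refl) y≢a | no _ = here refl
    select-dropVertex⁺ (x ∷ X) a (true ∷ v) (there y∈) y≢a | no _ = there (select-dropVertex⁺ X a v y∈ y≢a)
    select-dropVertex⁺ (x ∷ X) a (false ∷ v) y∈ y≢a | no _ = select-dropVertex⁺ X a v y∈ y≢a

    select-dropVertex⁻ : ∀ X → Unique X → ∀ a v {y} → y ∈ select X (dropVertex X a v) → y ∈ select X v × y ≢ a
    select-dropVertex⁻ [] _ a [] ()
    select-dropVertex⁻ (x ∷ X) uX a (b ∷ v) y∈ with x ≟ a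
    select-dropVertex⁻ (x ∷ X) uX a (true ∷ v) y∈ | yes refl =
      there y∈ , λ { refl → head∉tail uX (select-⊆ X v y∈) }
    select-dropVertex⁻ (x ∷ X) uX a (false ∷ v) y∈ | yes refl =
      y∈ , λ { refl → head∉tail uX (select-⊆ X v y∈) }
    select-dropVertex⁻ (x ∷ X) uX a (true ∷ v) (here refl) | no x≢a = here refl , x≢a
    select-dropVertex⁻ (x ∷ X) uX a (true ∷ v) (there y∈) | no _ with select-dropVertex⁻ X (tail-unique uX) a v y∈
    ... | y∈v , y≢a = there y∈v , y≢a
    select-dropVertex⁻ (x ∷ X) uX a (false ∷ v) y∈ | no _ = select-dropVertex⁻ X (tail-unique uX) a v y∈

    card-dropVertex : ∀ X → Unique X → ∀ a v → a ∈ select X v → card v ≡ suc (card (dropVertex X a v))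
    card-dropVertex [] _ a [] ()
    card-dropVertex (x ∷ X) uX a (true ∷ v) a∈ with x ≟ a
    ... | yes refl = refl
    ... | no x≢a = cong suc (card-dropVertex X (tail-unique uX) a v (∈-∷-≢ a∈ x≢a))
    card-dropVertex (x ∷ X) uX a (false ∷ v) a∈ with x ≟ a
    ... | yes refl = ⊥-elim (head∉tail uX (select-⊆ X v a∈))
    ... | no _ = card-dropVertex X (tail-unique uX) a v a∈

    cone-≢0 : ∀ X → Unique X → ∀ a (c : FaceChain (length X)) v → cone X a c v ≢ 0ℚ →
              a ∈ select X v × c (dropVertex X a v) ≢ 0ℚ
    cone-≢0 X uX a c v cone≢0 with a ∈? select X v
    ... | no a∉ = ⊥-elim (cone≢0 (cone-∉ X a c v a∉))
    ... | yes a∈ with cone-∈ X uX a c v a∈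
    ...   | inj₁ e = a∈ , λ c≡0 → cone≢0 (trans e c≡0)
    ...   | inj₂ e = a∈ , λ c≡0 → cone≢0 (trans e (cong -_ c≡0))

  IsSign : ℚ → Set
  IsSign q = q ≡ 1ℚ ⊎ q ≡ - 1ℚ

  IsSign-neg : ∀ {q} → IsSign q → IsSign (- q)
  IsSign-neg (inj₁ refl) = inj₂ refl
  IsSign-neg (inj₂ refl) = inj₁ refl

  IsSign⇒≢0 : ∀ {q} → IsSign q → q ≢ 0ℚ
  IsSign⇒≢0 (inj₁ refl) ()
  IsSign⇒≢0 (inj₂ refl) ()

  module _ {A : Set} where

    vertices : List (A × A) → List A
    vertices [] = []
    vertices ((a , b) ∷ Ps) = a ∷ b ∷ vertices Ps

    CrossRelated : Rel A _ → List (A × A) → Set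
    CrossRelated R [] = ⊤
    CrossRelated R ((a , b) ∷ Ps) = (∀ {y} → y ∈ vertices Ps → R a y × R b y) × CrossRelated R Ps

    crossRelated : ∀ {R : Rel A _} Ps → Unique (vertices Ps) →
      (∀ {a b} → (a , b) ∈ Ps → ∀ {y} → y ∈ vertices Ps → y ≢ a → y ≢ b → R a y × R b y) → CrossRelated R Ps
    crossRelated [] _ _ = tt
    crossRelated ((a , b) ∷ Ps) (a∉ ∷ b∉ ∷ uPs) related =
      (λ y∈ → related (here refl) (there (there y∈)) (λ { refl → All.lookup a∉ (there y∈) refl })
                                                     (λ { refl → All.lookup b∉ y∈ refl })) ,
      crossRelated Ps uPs (λ ab∈ → related (there ab∈) ∘ there ∘ there)

    OneOf : A → A → List A → Set
    OneOf a b σ = (a ∈ σ × b ∉ σ) ⊎ (a ∉ σ × b ∈ σ)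

    OneOfEach : List (A × A) → List A → Set
    OneOfEach [] σ = ⊤
    OneOfEach ((a , b) ∷ Ps) σ = OneOf a b σ × OneOfEach Ps σ

    OneOfEach-cong : ∀ Ps {σ σ′} → (∀ {y} → y ∈ vertices Ps → y ∈ σ → y ∈ σ′) →
                     (∀ {y} → y ∈ vertices Ps → y ∈ σ′ → y ∈ σ) → OneOfEach Ps σ → OneOfEach Ps σ′
    OneOfEach-cong [] _ _ _ = tt
    OneOfEach-cong ((a , b) ∷ Ps) {σ} {σ′} to from (choice , rest) =
      pick choice , OneOfEach-cong Ps (to ∘ there ∘ there) (from ∘ there ∘ there) rest
      where
      pick : OneOf a b σ → OneOf a b σ′
      pick (inj₁ (a∈ , b∉)) = inj₁ (to (here refl) a∈ , b∉ ∘ from (there (here refl)))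
      pick (inj₂ (a∉ , b∈)) = inj₂ (a∉ ∘ from (here refl) , to (there (here refl)) b∈)

    module _ (f : A → A) where

      pairUp : List A → List (A × A)
      pairUp = Data.List.map (λ a → a , f a)

      ∈-vertices-pairUp⁻ : ∀ L {y} → y ∈ vertices (pairUp L) → ∃ λ a → a ∈ L × (y ≡ a ⊎ y ≡ f a)
      ∈-vertices-pairUp⁻ (a ∷ L) (here refl) = a , here refl , inj₁ refl
      ∈-vertices-pairUp⁻ (a ∷ L) (there (here refl)) = a , here refl , inj₂ refl
      ∈-vertices-pairUp⁻ (a ∷ L) (there (there y∈)) =
        let (b , b∈L , y≡) = ∈-vertices-pairUp⁻ L y∈ in b , there b∈L , y≡

      ∈-vertices-pairUp⁺ : ∀ L {a} → a ∈ L → a ∈ vertices (pairUp L) × f a ∈ vertices (pairUp L)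
      ∈-vertices-pairUp⁺ (a ∷ L) (here refl) = here refl , there (here refl)
      ∈-vertices-pairUp⁺ (b ∷ L) (there a∈L) =
        let (a∈ , fa∈) = ∈-vertices-pairUp⁺ L a∈L in there (there a∈) , there (there fa∈)

      ∈-pairUp⁻ : ∀ L {a b} → (a , b) ∈ pairUp L → a ∈ L × b ≡ f a
      ∈-pairUp⁻ (c ∷ L) (here refl) = here refl , refl
      ∈-pairUp⁻ (c ∷ L) (there ab∈) = let (a∈L , b≡) = ∈-pairUp⁻ L ab∈ in there a∈L , b≡

      pairUp-unique : ∀ L → Unique L → (∀ {a b} → a ∈ L → b ∈ L → f a ≢ b) →
                      (∀ {a b} → a ∈ L → b ∈ L → f a ≡ f b → a ≡ b) → Unique (vertices (pairUp L))
      pairUp-unique [] _ _ _ = []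
      pairUp-unique (a ∷ L) (a∉L ∷ uL) f≢ f-inj =
        All.tabulate aFresh ∷ All.tabulate faFresh ∷ pairUp-unique L uL (λ a∈ b∈ → f≢ (there a∈) (there b∈))
                                                            (λ a∈ b∈ → f-inj (there a∈) (there b∈))
        where
        aFresh : ∀ {y} → y ∈ f a ∷ vertices (pairUp L) → a ≢ y
        aFresh (here refl) a≡fa = f≢ (here refl) (here refl) (sym a≡fa)
        aFresh (there y∈) a≡y with ∈-vertices-pairUp⁻ L y∈
        ... | b , b∈L , inj₁ refl = All.lookup a∉L b∈L a≡y
        ... | b , b∈L , inj₂ refl = f≢ (there b∈L) (here refl) (sym a≡y)
        faFresh : ∀ {y} → y ∈ vertices (pairUp L) → f a ≢ y
        faFresh y∈ fa≡y with ∈-vertices-pairUp⁻ L y∈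
        ... | b , b∈L , inj₁ refl = f≢ (here refl) (there b∈L) fa≡y
        ... | b , b∈L , inj₂ refl = All.lookup a∉L b∈L (f-inj (here refl) (there b∈L) fa≡y)

  module CrossPolytope {A : Set} (_≟_ : DecidableEquality A) (X : List A) (uX : Unique X) where

    open Faces _≟_
    open Cone _≟_
    open import Data.List.Membership.DecPropositional _≟_ using (_∈?_)

    -- The fundamental cycle (a₁ − b₁) * ⋯ * (aₖ − bₖ) of the boundary of the cross-polytope on the pairs.
    crossPolytope : List (A × A) → FaceChain (length X)
    crossPolytope [] = emptySimplex
    crossPolytope ((a , b) ∷ Ps) v = cone X a (crossPolytope Ps) v - cone X b (crossPolytope Ps) v

    crossPolytope-≢0 : ∀ a b Ps v → crossPolytope ((a , b) ∷ Ps) v ≢ 0ℚ →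
      ∃ λ t → (t ≡ a ⊎ t ≡ b) × t ∈ select X v × crossPolytope Ps (dropVertex X t v) ≢ 0ℚ
    crossPolytope-≢0 a b Ps v z≢0 with cone X a (crossPolytope Ps) v ℚ.≟ 0ℚ
    ... | no coneA≢0 = let (a∈ , z′≢0) = cone-≢0 X uX a (crossPolytope Ps) v coneA≢0 in a , inj₁ refl , a∈ , z′≢0
    ... | yes coneA≡0 with cone X b (crossPolytope Ps) v ℚ.≟ 0ℚ
    ...   | no coneB≢0 = let (b∈ , z′≢0) = cone-≢0 X uX b (crossPolytope Ps) v coneB≢0 in b , inj₂ refl , b∈ , z′≢0
    ...   | yes coneB≡0 = ⊥-elim (z≢0 (cong₂ _-_ coneA≡0 coneB≡0))

    crossPolytope-⊆ : ∀ Ps v → crossPolytope Ps v ≢ 0ℚ → ∀ {y} → y ∈ select X v → y ∈ vertices Ps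
    crossPolytope-⊆ [] v z≢0 y∈ = ⊥-elim (z≢0 (emptySimplex-∈ X v y∈))
    crossPolytope-⊆ ((a , b) ∷ Ps) v z≢0 {y} y∈ with crossPolytope-≢0 a b Ps v z≢0
    ... | t , t≡a⊎b , _ , z′≢0 with y ≟ t | t≡a⊎b
    ...   | yes refl | inj₁ refl = here refl
    ...   | yes refl | inj₂ refl = there (here refl)
    ...   | no y≢t | _ = there (there (crossPolytope-⊆ Ps (dropVertex X t v) z′≢0 (select-dropVertex⁺ X t v y∈ y≢t)))

    crossPolytope-vanishes : ∀ Ps v {y} → y ∈ select X v → y ∉ vertices Ps → crossPolytope Ps v ≡ 0ℚ
    crossPolytope-vanishes Ps v y∈ y∉ with crossPolytope Ps v ℚ.≟ 0ℚ
    ... | yes z≡0 = z≡0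
    ... | no z≢0 = ⊥-elim (y∉ (crossPolytope-⊆ Ps v z≢0 y∈))

    crossPolytope-cycle : ∀ Ps → Unique (vertices Ps) → All (_∈ X) (vertices Ps) →
                          ∀ w → ∂ᶠ (crossPolytope Ps) w ≡ 0ℚ
    crossPolytope-cycle [] _ _ w = ∂ᶠ-emptySimplex w
    crossPolytope-cycle ((a , b) ∷ Ps) (a∉ ∷ b∉ ∷ uPs) (a∈X ∷ b∈X ∷ Ps⊆X) w = begin
      ∂ᶠ (λ v → cone X a z v - cone X b z v) w
        ≡⟨ ∂ᶠ-+ (cone X a z) (-_ ∘ cone X b z) w ⟩
      ∂ᶠ (cone X a z) w + ∂ᶠ (-_ ∘ cone X b z) w
        ≡⟨ cong (∂ᶠ (cone X a z) w +_) (∂ᶠ-neg (cone X b z) w) ⟩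
      ∂ᶠ (cone X a z) w - ∂ᶠ (cone X b z) w
        ≡⟨ cong₂ _-_ (∂ᶠ-cone a a∈X (λ a∈Ps → All.lookup a∉ (there a∈Ps) refl))
                     (∂ᶠ-cone b b∈X (λ b∈Ps → All.lookup b∉ b∈Ps refl)) ⟩
      z w - z w
        ≡⟨ ℚP.+-inverseʳ (z w) ⟩
      0ℚ ∎
      where
      z = crossPolytope Ps
      ∂z≡0 = crossPolytope-cycle Ps uPs Ps⊆X
      ∂ᶠ-cone : ∀ t → t ∈ X → t ∉ vertices Ps → ∂ᶠ (cone X t z) w ≡ z w
      ∂ᶠ-cone t t∈X t∉Ps = begin
        ∂ᶠ (cone X t z) w          ≡⟨ cone-boundary X t z t∈X (λ v t∈v → crossPolytope-vanishes Ps v t∈v t∉Ps) w ⟩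
        z w - cone X t (∂ᶠ z) w    ≡⟨ cong (_-_ (z w)) (cone-zero X t (∂ᶠ z) ∂z≡0 w) ⟩
        z w - 0ℚ                   ≡⟨ ℚP.+-identityʳ (z w) ⟩
        z w                        ∎

    crossPolytope-card : ∀ Ps v → crossPolytope Ps v ≢ 0ℚ → card v ≡ length Ps
    crossPolytope-card [] v z≢0 = emptySimplex-card v z≢0
    crossPolytope-card ((a , b) ∷ Ps) v z≢0 with crossPolytope-≢0 a b Ps v z≢0
    ... | t , _ , t∈ , z′≢0 =
      trans (card-dropVertex X uX t v t∈) (cong suc (crossPolytope-card Ps (dropVertex X t v) z′≢0))

    -- A face in the support takes one vertex from each pair, so only vertices of different pairs meet.
    crossPolytope-related : ∀ {R : Rel A _} → Reflexive R → Symmetric R → ∀ Ps → CrossRelated R Ps →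
      ∀ v → crossPolytope Ps v ≢ 0ℚ → ∀ {x y} → x ∈ select X v → y ∈ select X v → R x y
    crossPolytope-related R-refl R-sym [] _ v z≢0 x∈ _ = ⊥-elim (z≢0 (emptySimplex-∈ X v x∈))
    crossPolytope-related {R} R-refl R-sym ((a , b) ∷ Ps) (R-ab , R-Ps) v z≢0
      with crossPolytope-≢0 a b Ps v z≢0
    ... | t , t≡a⊎b , _ , z′≢0 = related
      where
      R-pair : ∀ {s} → s ≡ a ⊎ s ≡ b → ∀ {u} → u ∈ vertices Ps → R s u
      R-pair (inj₁ refl) u∈ = proj₁ (R-ab u∈)
      R-pair (inj₂ refl) u∈ = proj₂ (R-ab u∈)
      inPs : ∀ {u} → u ∈ select X v → u ≢ t → u ∈ vertices Ps
      inPs u∈ u≢t = crossPolytope-⊆ Ps (dropVertex X t v) z′≢0 (select-dropVertex⁺ X t v u∈ u≢t)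
      related : ∀ {x y} → x ∈ select X v → y ∈ select X v → R x y
      related {x} {y} x∈ y∈ with x ≟ t | y ≟ t
      ... | yes refl | yes refl = R-refl
      ... | yes refl | no y≢t = R-pair t≡a⊎b (inPs y∈ y≢t)
      ... | no x≢t | yes refl = R-sym (R-pair t≡a⊎b (inPs x∈ x≢t))
      ... | no x≢t | no y≢t = crossPolytope-related R-refl R-sym Ps R-Ps (dropVertex X t v) z′≢0
                                (select-dropVertex⁺ X t v x∈ x≢t) (select-dropVertex⁺ X t v y∈ y≢t)

    cone-sign : ∀ t (c : FaceChain (length X)) v → t ∈ select X v → IsSign (c (dropVertex X t v)) →
                IsSign (cone X t c v)
    cone-sign t c v t∈ ±1 with cone-∈ X uX t c v t∈
    ... | inj₁ e = subst IsSign (sym e) ±1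
    ... | inj₂ e = subst IsSign (sym e) (IsSign-neg ±1)

    transversal-dropVertex : ∀ Ps t v → t ∉ vertices Ps →
      (∀ {y} → y ∈ select X v → y ≢ t → y ∈ vertices Ps) → OneOfEach Ps (select X v) →
      (∀ {y} → y ∈ select X (dropVertex X t v) → y ∈ vertices Ps) × OneOfEach Ps (select X (dropVertex X t v))
    transversal-dropVertex Ps t v t∉Ps rest⊆Ps oneOfEach =
      (λ y∈ → let (y∈v , y≢t) = select-dropVertex⁻ X uX t v y∈ in rest⊆Ps y∈v y≢t) ,
      OneOfEach-cong Ps (λ y∈Ps y∈ → select-dropVertex⁺ X t v y∈ (λ { refl → t∉Ps y∈Ps }))
                        (λ _ y∈ → proj₁ (select-dropVertex⁻ X uX t v y∈)) oneOfEach

    crossPolytope-transversal : ∀ Ps → Unique (vertices Ps) → ∀ v →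
      (∀ {y} → y ∈ select X v → y ∈ vertices Ps) → OneOfEach Ps (select X v) → IsSign (crossPolytope Ps v)
    crossPolytope-transversal [] _ v ⊆[] _ = inj₁ (emptySimplex-∉ X v (λ y∈ → ∉[] (⊆[] y∈)))
      where
      ∉[] : ∀ {y : A} → y ∉ []
      ∉[] ()
    crossPolytope-transversal ((a , b) ∷ Ps) (a∉ ∷ b∉ ∷ uPs) v ⊆Ps (inj₁ (a∈ , b∉v) , oneOfEach) =
      subst IsSign (sym (trans (cong (_-_ (cone X a z v)) (cone-∉ X b z v b∉v)) (ℚP.+-identityʳ _)))
        (cone-sign a z v a∈ (uncurry (crossPolytope-transversal Ps uPs (dropVertex X a v))
          (transversal-dropVertex Ps a v (λ a∈Ps → All.lookup a∉ (there a∈Ps) refl) rest⊆Ps oneOfEach)))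
      where
      z = crossPolytope Ps
      rest⊆Ps : ∀ {y} → y ∈ select X v → y ≢ a → y ∈ vertices Ps
      rest⊆Ps y∈ y≢a with ⊆Ps y∈
      ... | here refl = ⊥-elim (y≢a refl)
      ... | there (here refl) = ⊥-elim (b∉v y∈)
      ... | there (there y∈Ps) = y∈Ps
    crossPolytope-transversal ((a , b) ∷ Ps) (a∉ ∷ b∉ ∷ uPs) v ⊆Ps (inj₂ (a∉v , b∈) , oneOfEach) =
      subst IsSign (sym (trans (cong (_- cone X b z v) (cone-∉ X a z v a∉v)) (ℚP.+-identityˡ _)))
        (IsSign-neg (cone-sign b z v b∈ (uncurry (crossPolytope-transversal Ps uPs (dropVertex X b v))
          (transversal-dropVertex Ps b v (λ b∈Ps → All.lookup b∉ b∈Ps refl) rest⊆Ps oneOfEach))))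
      where
      z = crossPolytope Ps
      rest⊆Ps : ∀ {y} → y ∈ select X v → y ≢ b → y ∈ vertices Ps
      rest⊆Ps y∈ y≢b with ⊆Ps y∈
      ... | here refl = ⊥-elim (a∉v y∈)
      ... | there (here refl) = ⊥-elim (y≢b refl)
      ... | there (there y∈Ps) = y∈Ps

    oneOfEach-charVec : ∀ (g : A → Bool) Ps → All (_∈ X) (vertices Ps) →
      (∀ {a b} → (a , b) ∈ Ps → g b ≡ not (g a)) → OneOfEach Ps (select X (charVec X g))
    oneOfEach-charVec g [] _ _ = tt
    oneOfEach-charVec g ((a , b) ∷ Ps) (a∈X ∷ b∈X ∷ Ps⊆X) complementary =
      pick (g a) refl (complementary (here refl)) , oneOfEach-charVec g Ps Ps⊆X (complementary ∘ there)
      where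
      chosen⇒∈ : ∀ {y} → y ∈ X → g y ≡ true → y ∈ select X (charVec X g)
      chosen⇒∈ y∈X gy = select-charVec⁺ X g y∈X gy
      ∈⇒chosen : ∀ {y} → g y ≡ false → y ∉ select X (charVec X g)
      ∈⇒chosen gy y∈ with () ← trans (sym gy) (select-charVec⁻ X g y∈)
      pick : ∀ c → g a ≡ c → g b ≡ not c → OneOf a b (select X (charVec X g))
      pick true ga gb = inj₁ (chosen⇒∈ a∈X ga , ∈⇒chosen gb)
      pick false ga gb = inj₂ (∈⇒chosen ga , chosen⇒∈ b∈X gb)

  Σ-zero : ∀ N (f : Fin N → ℚ) → (∀ j → f j ≡ 0ℚ) → Σ N f ≡ 0ℚ
  Σ-zero zero f _ = refl
  Σ-zero (suc N) f f≡0 = trans (cong₂ _+_ (f≡0 Fin.zero) (Σ-zero N (f ∘ Fin.suc) (f≡0 ∘ Fin.suc))) (ℚP.+-identityʳ 0ℚ)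

  Σ-single : ∀ N (f : Fin N → ℚ) j → (∀ k → k ≢ j → f k ≡ 0ℚ) → Σ N f ≡ f j
  Σ-single (suc N) f Fin.zero f≡0 =
    trans (cong (f Fin.zero +_) (Σ-zero N (f ∘ Fin.suc) (λ k → f≡0 (Fin.suc k) (λ ()))))
          (ℚP.+-identityʳ (f Fin.zero))
  Σ-single (suc N) f (Fin.suc j) f≡0 =
    trans (cong₂ _+_ (f≡0 Fin.zero (λ ()))
                     (Σ-single N (f ∘ Fin.suc) j (λ k k≢j → f≡0 (Fin.suc k) (k≢j ∘ FinP.suc-injective))))
          (ℚP.+-identityˡ (f (Fin.suc j)))

  IsSign-cancel : ∀ a {q} → IsSign q → a * q ≡ 0ℚ → a ≡ 0ℚ
  IsSign-cancel a (inj₁ refl) aq≡0 = trans (sym (ℚP.*-identityʳ a)) aq≡0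
  IsSign-cancel a (inj₂ refl) aq≡0 =
    ℚP.neg-injective (trans (trans (cong -_ (sym (ℚP.*-identityʳ a))) (ℚP.neg-distribʳ-* a 1ℚ)) aq≡0)

  removeAt-drops : ∀ {A : Set} (τ : List A) i → Unique τ →
                   length (removeAt τ i) ≡ length τ ⊎ ∃ λ y → y ∈ τ × y ∉ removeAt τ i
  removeAt-drops [] i _ = inj₁ refl
  removeAt-drops (x ∷ τ) zero (x∉τ ∷ _) = inj₂ (x , here refl , λ x∈τ → All.lookup x∉τ x∈τ refl)
  removeAt-drops (x ∷ τ) (suc i) (x∉τ ∷ uτ) with removeAt-drops τ i uτ
  ... | inj₁ same = inj₁ (cong suc same)
  ... | inj₂ (y , y∈τ , y∉) = inj₂ (y , there y∈τ , λ
    { (here refl) → All.lookup x∉τ y∈τ refl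
    ; (there y∈) → y∉ y∈ })

  module VietorisRips {A : Set} (_≟_ : DecidableEquality A) (d : A → A → ℕ) (r : ℕ)
                      (X : List A) (uX : Unique X) where

    open Incidence _≟_
    open Faces _≟_
    open CrossPolytope _≟_ X uX

    IsRips : List A → Set
    IsRips τ = All (λ x → All (λ y → d x y ≤ r) τ) τ

    IsRips? : Decidable IsRips
    IsRips? τ = all? (λ x → all? (λ y → d x y ≤? r) τ) τ

    restrict : FaceChain (length X) → ∀ k → Ch _≟_ d r X k
    restrict z k i = z (faceVec X (lookup (VRsimplices d r X k) i))

    restrict-cycle : ∀ (z : FaceChain (length X)) → (∀ w → ∂ᶠ z w ≡ 0ℚ) →
                     (∀ v → z v ≢ 0ℚ → IsRips (select X v)) → ∀ k → IsCycle _≟_ d r X k (restrict z k)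
    restrict-cycle z ∂z≡0 supp zero = _
    restrict-cycle z ∂z≡0 supp (suc q) j
      with combinations⇒select X (suc q)
             (proj₁ (∈-filter⁻ IsRips? {xs = combinations (suc q) X} (∈-lookup {xs = VRsimplices d r X q} j)))
    ... | w , ∣w∣ , ρ≡ = begin
      Σ (length Sp) (λ i → incidence _≟_ (lookup Sp i) ρ * zᶠ (lookup Sp i))
        ≡⟨ Σ-lookup (λ σ → incidence _≟_ σ ρ * zᶠ σ) Sp ⟩
      listSum (λ σ → incidence _≟_ σ ρ * zᶠ σ) Sp
        ≡⟨ listSum-filter IsRips? (λ σ → incidence _≟_ σ ρ * zᶠ σ) (combinations (suc (suc q)) X) nonRips≡0 ⟩
      listSum (λ σ → incidence _≟_ σ ρ * zᶠ σ) (combinations (suc (suc q)) X)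
        ≡⟨ cong₂ (λ ρ k → listSum (λ σ → incidence _≟_ σ ρ * zᶠ σ) (combinations (suc k) X)) ρ≡ (sym ∣w∣) ⟩
      listSum (λ σ → incidence _≟_ σ (select X w) * zᶠ σ) (combinations (suc (card w)) X)
        ≡⟨ listSum-incidence X uX w zᶠ ⟩
      ∂ᶠ (zᶠ ∘ select X) w
        ≡⟨ ∂ᶠ-cong (zᶠ ∘ select X) z (cong z ∘ faceVec-select X uX) w ⟩
      ∂ᶠ z w
        ≡⟨ ∂z≡0 w ⟩
      0ℚ ∎
      where
      Sp = VRsimplices d r X (suc q)
      ρ = lookup (VRsimplices d r X q) j
      zᶠ = z ∘ faceVec X
      nonRips≡0 : ∀ {σ} → σ ∈ combinations (suc (suc q)) X → ¬ IsRips σ → incidence _≟_ σ ρ * zᶠ σ ≡ 0ℚ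
      nonRips≡0 {σ} σ∈ ¬rips with combinations⇒select X (suc (suc q)) σ∈
      ... | u , _ , refl with z u ℚ.≟ 0ℚ
      ...   | yes zu≡0 = trans (cong (incidence _≟_ (select X u) ρ *_) (trans (cong z (faceVec-select X uX u)) zu≡0))
                               (ℚP.*-zeroʳ (incidence _≟_ (select X u) ρ))
      ...   | no zu≢0 = ⊥-elim (¬rips (supp u zu≢0))

    not-a-facet : ∀ p σ → length σ ≡ suc p → (∀ {y} → y ∈ X → y ∉ σ → ∃ λ x → x ∈ σ × ¬ (d x y ≤ r)) →
                  ∀ {τ} → τ ∈ VRsimplices d r X (suc p) → ∀ i → removeAt τ i ≢ σ
    not-a-facet p σ ∣σ∣ far {τ} τ∈ i τ∖i≡σ with ∈-filter⁻ IsRips? {xs = combinations (suc (suc p)) X} τ∈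
    ... | τ∈comb , ripsτ with combinations⇒select X (suc (suc p)) τ∈comb
    ...   | u , ∣u∣ , refl with removeAt-drops (select X u) i (select-unique X uX u)
    ...     | inj₁ sameLength = ℕP.1+n≢n (begin
      suc (suc p)                      ≡⟨ sym ∣u∣ ⟩
      card u                           ≡⟨ sym (length-select X u) ⟩
      length (select X u)              ≡⟨ sym sameLength ⟩
      length (removeAt (select X u) i) ≡⟨ cong length τ∖i≡σ ⟩
      length σ                         ≡⟨ ∣σ∣ ⟩
      suc p                            ∎)
    ...     | inj₂ (y , y∈τ , y∉) with far (select-⊆ X u y∈τ) (subst (y ∉_) τ∖i≡σ y∉)
    ...       | x , x∈σ , x≁y =
      x≁y (All.lookup (All.lookup ripsτ (removeAt-⊆ (select X u) i (subst (x ∈_) (sym τ∖i≡σ) x∈σ))) y∈τ)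

    homologyRank≥ : ∀ p N (c : Fin N → Ch _≟_ d r X p) (σ : Fin N → Fin (length (VRsimplices d r X p))) →
      (∀ j → IsCycle _≟_ d r X p (c j)) → (∀ j → IsSign (c j (σ j))) → (∀ j k → k ≢ j → c k (σ j) ≡ 0ℚ) →
      (∀ j {τ} → τ ∈ VRsimplices d r X (suc p) → ∀ i → removeAt τ i ≢ lookup (VRsimplices d r X p) (σ j)) →
      HomologyRank≥ _≟_ d r X p N
    homologyRank≥ p N c σ cycles ±1 c≡0 maximal = c , cycles , independent
      where
      independent : ∀ (a : Fin N → ℚ) (b : Ch _≟_ d r X (suc p)) →
                    (∀ i → Σ N (λ j → a j * c j i) ≡ ∂ _≟_ d r X p b i) → ∀ j → a j ≡ 0ℚ
      independent a b a·c≡∂b j = IsSign-cancel (a j) (±1 j) (begin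
        a j * c j (σ j)                   ≡⟨ sym (Σ-single N (λ k → a k * c k (σ j)) j
                                                  (λ k k≢j → trans (cong (a k *_) (c≡0 j k k≢j)) (ℚP.*-zeroʳ (a k)))) ⟩
        Σ N (λ k → a k * c k (σ j))       ≡⟨ a·c≡∂b (σ j) ⟩
        ∂ _≟_ d r X p b (σ j)             ≡⟨ Σ-zero (length Sp) _ (λ l → trans (cong (_* b l) (noFacet l))
                                                                                   (ℚP.*-zeroˡ (b l))) ⟩
        0ℚ                                ∎)
        where
        Sp = VRsimplices d r X (suc p)
        noFacet : ∀ l → incidence _≟_ (lookup Sp l) (lookup (VRsimplices d r X p) (σ j)) ≡ 0ℚ
        noFacet l = incidence-≢ (lookup Sp l) _ (maximal j (∈-lookup l))

    -- A cross-polytope in VR(X; r) (no distance bound is needed within a pair) with a facet, the vertices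
    -- where `chosen` holds, that is a maximal simplex of VR(X; r).
    record MarkedSphere : Set where
      field
        pairs : List (A × A)
        vertices-unique : Unique (vertices pairs)
        vertices-⊆ : All (_∈ X) (vertices pairs)
        close : CrossRelated (λ x y → d x y ≤ r) pairs
        chosen : A → Bool
        complementary : ∀ {a b} → (a , b) ∈ pairs → chosen b ≡ not (chosen a)
        chosen⇒vertex : ∀ {y} → y ∈ X → chosen y ≡ true → y ∈ vertices pairs
        far : ∀ {y} → y ∈ X → chosen y ≡ false → ∃ λ x → x ∈ X × chosen x ≡ true × ¬ (d x y ≤ r)

      sphere : FaceChain (length X)
      sphere = crossPolytope pairs

      marked : Vec Bool (length X)
      marked = charVec X chosen

      facet : List A
      facet = select X marked

    module _ (d-refl : ∀ x → d x x ≤ r) (d-sym : ∀ x y → d x y ≡ d y x) where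

      open MarkedSphere

      sphere-rips : ∀ s v → sphere s v ≢ 0ℚ → IsRips (select X v)
      sphere-rips s v z≢0 = All.tabulate λ x∈ → All.tabulate λ y∈ →
        crossPolytope-related (d-refl _) (λ {x} {y} → subst (_≤ r) (d-sym x y)) (pairs s) (close s) v z≢0 x∈ y∈

      facet-sign : ∀ s → IsSign (sphere s (marked s))
      facet-sign s = crossPolytope-transversal (pairs s) (vertices-unique s) (marked s)
        (λ y∈ → chosen⇒vertex s (select-⊆ X (marked s) y∈) (select-charVec⁻ X (chosen s) y∈))
        (oneOfEach-charVec (chosen s) (pairs s) (vertices-⊆ s) (complementary s))

      card-marked : ∀ s → card (marked s) ≡ length (pairs s)
      card-marked s = crossPolytope-card (pairs s) (marked s) (IsSign⇒≢0 (facet-sign s))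

      facet-simplex : ∀ p s → length (pairs s) ≡ suc p → facet s ∈ VRsimplices d r X p
      facet-simplex p s ∣pairs∣ =
        ∈-filter⁺ IsRips? (subst (λ k → facet s ∈ combinations k X) (trans (card-marked s) ∣pairs∣)
                                                                    (select∈combinations X (marked s)))
                          (sphere-rips s (marked s) (IsSign⇒≢0 (facet-sign s)))

      facet-maximal : ∀ p s → length (pairs s) ≡ suc p →
                      ∀ {τ} → τ ∈ VRsimplices d r X (suc p) → ∀ i → removeAt τ i ≢ facet s
      facet-maximal p s ∣pairs∣ =
        not-a-facet p (facet s) (trans (length-select X (marked s)) (trans (card-marked s) ∣pairs∣)) farFromFacet
        where
        farFromFacet : ∀ {y} → y ∈ X → y ∉ facet s → ∃ λ x → x ∈ facet s × ¬ (d x y ≤ r)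
        farFromFacet {y} y∈X y∉facet with chosen s y in chosenY
        ... | true = ⊥-elim (y∉facet (select-charVec⁺ X (chosen s) y∈X chosenY))
        ... | false = let (x , x∈X , chosenX , x≁y) = far s y∈X chosenY in
                      x , select-charVec⁺ X (chosen s) x∈X chosenX , x≁y

      homologyRank≥-spheres : ∀ p N (s : Fin N → MarkedSphere) → (∀ j → length (pairs (s j)) ≡ suc p) →
        (∀ j k → k ≢ j → ∃ λ x → x ∈ X × chosen (s j) x ≡ true × x ∉ vertices (pairs (s k))) →
        HomologyRank≥ _≟_ d r X p N
      homologyRank≥-spheres p N s ∣pairs∣ separated =
        homologyRank≥ p N (λ j → restrict (sphere (s j)) p) index cycle signed vanishes maximal
        where
        facet∈ : ∀ j → facet (s j) ∈ VRsimplices d r X p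
        facet∈ j = facet-simplex p (s j) (∣pairs∣ j)
        index : Fin N → Fin (length (VRsimplices d r X p))
        index j = Any.index (facet∈ j)
        lookup-index : ∀ j → lookup (VRsimplices d r X p) (index j) ≡ facet (s j)
        lookup-index j = sym (AnyP.lookup-index (facet∈ j))
        value : ∀ k j → restrict (sphere (s k)) p (index j) ≡ sphere (s k) (marked (s j))
        value k j = cong (sphere (s k)) (trans (cong (faceVec X) (lookup-index j)) (faceVec-select X uX (marked (s j))))
        cycle : ∀ j → IsCycle _≟_ d r X p (restrict (sphere (s j)) p)
        cycle j = restrict-cycle (sphere (s j)) (crossPolytope-cycle (pairs (s j)) (vertices-unique (s j)) (vertices-⊆ (s j)))
                                 (sphere-rips (s j)) p
        signed : ∀ j → IsSign (restrict (sphere (s j)) p (index j))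
        signed j = subst IsSign (sym (value j j)) (facet-sign (s j))
        vanishes : ∀ j k → k ≢ j → restrict (sphere (s k)) p (index j) ≡ 0ℚ
        vanishes j k k≢j with separated j k k≢j
        ... | x , x∈X , chosenX , x∉ =
          trans (value k j) (crossPolytope-vanishes (pairs (s k)) (marked (s j))
                                                    (select-charVec⁺ X (chosen (s j)) x∈X chosenX) x∉)
        maximal : ∀ j {τ} → τ ∈ VRsimplices d r X (suc p) → ∀ i → removeAt τ i ≢ lookup (VRsimplices d r X p) (index j)
        maximal j {τ} τ∈ i = subst (removeAt τ i ≢_) (sym (lookup-index j)) (facet-maximal p (s j) (∣pairs∣ j) τ∈ i)

module SubsetCombinatorics where

  import Data.Bool.Properties as BoolP
  open import Data.Fin.Subset
    using (_⊆_; _∩_; _∪_; _─_; _-_; ⁅_⁆; Nonempty; inside; outside)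
    renaming (_∈_ to _∈ₛ_; _∉_ to _∉ₛ_; ⊤ to ⊤ₛ; ⊥ to ⊥ₛ)
  open import Data.Fin.Subset.Properties
    using (drop-there; drop-∷-⊆; out⊆; s⊆s; ⊥⊆; ⊆⊤; p─⊥≡p; ∪-identityˡ; ⊆-trans; ⊆-antisym;
           x∈⁅x⁆; x∈⁅y⁆⇒x≡y; x∉⁅y⁆⇒x≢y; p─q⊆p; x∈p∧x∉q⇒x∈p─q; x∈p∧x≢y⇒x∈p-y;
           x∈p∩q⁺; x∈p∩q⁻; x∈p∪q⁺; x∈p∪q⁻; p∩q⊆p; p∩q⊆q; nonempty?; _∈?_; _⊆?_)
  import Data.List.Relation.Unary.Unique.Propositional.Properties as Unique
  open import Data.Nat using (_+_; _*_; _∸_; _/_)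
  open import Data.Nat.Combinatorics using (_C_; nCk+nC[k+1]≡[n+1]C[k+1]; nCk≡nC[n∸k])
  open import Data.Nat.DivMod using (m*n/n≡m)
  open import Data.Vec using (here; there)
  open import Data.Vec.Properties using (∷-injectiveʳ)
  open Homology

  x∈p─q⇒x∉q : ∀ {m} {x : Fin m} (p q : Subset m) → x ∈ₛ p ─ q → x ∉ₛ q
  x∈p─q⇒x∉q (inside ∷ p) (outside ∷ q) here = λ ()
  x∈p─q⇒x∉q {x = Fin.zero} (_ ∷ p) (inside ∷ q) ()
  x∈p─q⇒x∉q {x = Fin.zero} (outside ∷ p) (outside ∷ q) ()
  x∈p─q⇒x∉q (_ ∷ p) (_ ∷ q) (there x∈) = x∈p─q⇒x∉q p q x∈ ∘ drop-there

  card-─ : ∀ {m} (p q : Subset m) → q ⊆ p → card (p ─ q) + card q ≡ card p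
  card-─ [] [] _ = refl
  card-─ (inside ∷ p) (inside ∷ q) q⊆p =
    trans (ℕP.+-suc (card (p ─ q)) (card q)) (cong suc (card-─ p q (drop-∷-⊆ q⊆p)))
  card-─ (inside ∷ p) (outside ∷ q) q⊆p = cong suc (card-─ p q (drop-∷-⊆ q⊆p))
  card-─ (outside ∷ p) (inside ∷ q) q⊆p with () ← q⊆p here
  card-─ (outside ∷ p) (outside ∷ q) q⊆p = card-─ p q (drop-∷-⊆ q⊆p)

  symDiffDist+card-∩ : ∀ {m} (p q : Subset m) →
    symDiffDist p q + (card (p ∩ q) + card (p ∩ q)) ≡ card p + card q
  symDiffDist+card-∩ [] [] = refl
  symDiffDist+card-∩ (inside ∷ p) (inside ∷ q) = begin
    d + (suc c + suc c)   ≡⟨ cong (d +_) (cong suc (ℕP.+-suc c c)) ⟩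
    d + suc (suc (c + c)) ≡⟨ ℕP.+-suc d (suc (c + c)) ⟩
    suc (d + suc (c + c)) ≡⟨ cong suc (ℕP.+-suc d (c + c)) ⟩
    suc (suc (d + (c + c))) ≡⟨ cong (λ k → suc (suc k)) (symDiffDist+card-∩ p q) ⟩
    suc (suc (card p + card q)) ≡⟨ cong suc (sym (ℕP.+-suc (card p) (card q))) ⟩
    suc (card p + suc (card q)) ∎
    where
    open ≡-Reasoning
    d = symDiffDist p q
    c = card (p ∩ q)
  symDiffDist+card-∩ (inside ∷ p) (outside ∷ q) = cong suc (symDiffDist+card-∩ p q)
  symDiffDist+card-∩ (outside ∷ p) (inside ∷ q) =
    trans (cong suc (symDiffDist+card-∩ p q)) (sym (ℕP.+-suc (card p) (card q)))
  symDiffDist+card-∩ (outside ∷ p) (outside ∷ q) = symDiffDist+card-∩ p q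

  symDiffDist-self : ∀ {m} (p : Subset m) → symDiffDist p p ≡ 0
  symDiffDist-self [] = refl
  symDiffDist-self (inside ∷ p) = symDiffDist-self p
  symDiffDist-self (outside ∷ p) = symDiffDist-self p

  symDiffDist-comm : ∀ {m} (p q : Subset m) → symDiffDist p q ≡ symDiffDist q p
  symDiffDist-comm [] [] = refl
  symDiffDist-comm (inside ∷ p) (inside ∷ q) = symDiffDist-comm p q
  symDiffDist-comm (inside ∷ p) (outside ∷ q) = cong suc (symDiffDist-comm p q)
  symDiffDist-comm (outside ∷ p) (inside ∷ q) = cong suc (symDiffDist-comm p q)
  symDiffDist-comm (outside ∷ p) (outside ∷ q) = symDiffDist-comm p q

  ⊆⇒card≤ : ∀ {m} {p q : Subset m} → p ⊆ q → card p ≤ card q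
  ⊆⇒card≤ {p = []} {[]} _ = z≤n
  ⊆⇒card≤ {p = inside ∷ p} {inside ∷ q} p⊆q = s≤s (⊆⇒card≤ (drop-∷-⊆ p⊆q))
  ⊆⇒card≤ {p = inside ∷ p} {outside ∷ q} p⊆q with () ← p⊆q here
  ⊆⇒card≤ {p = outside ∷ p} {inside ∷ q} p⊆q = ℕP.m≤n⇒m≤1+n (⊆⇒card≤ (drop-∷-⊆ p⊆q))
  ⊆⇒card≤ {p = outside ∷ p} {outside ∷ q} p⊆q = ⊆⇒card≤ (drop-∷-⊆ p⊆q)

  ⊆∧card≥⇒≡ : ∀ {m} {p q : Subset m} → p ⊆ q → card q ≤ card p → p ≡ q
  ⊆∧card≥⇒≡ {p = []} {[]} _ _ = refl
  ⊆∧card≥⇒≡ {p = inside ∷ p} {inside ∷ q} p⊆q (s≤s q≤p) = cong (inside ∷_) (⊆∧card≥⇒≡ (drop-∷-⊆ p⊆q) q≤p)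
  ⊆∧card≥⇒≡ {p = inside ∷ p} {outside ∷ q} p⊆q _ with () ← p⊆q here
  ⊆∧card≥⇒≡ {p = outside ∷ p} {inside ∷ q} p⊆q q≤p =
    ⊥-elim (ℕP.<-irrefl refl (ℕP.≤-trans q≤p (⊆⇒card≤ (drop-∷-⊆ p⊆q))))
  ⊆∧card≥⇒≡ {p = outside ∷ p} {outside ∷ q} p⊆q q≤p = cong (outside ∷_) (⊆∧card≥⇒≡ (drop-∷-⊆ p⊆q) q≤p)

  card>0⇒nonempty : ∀ {m} (p : Subset m) → 1 ≤ card p → Nonempty p
  card>0⇒nonempty (inside ∷ p) _ = Fin.zero , here
  card>0⇒nonempty (outside ∷ p) 1≤∣p∣ with card>0⇒nonempty p 1≤∣p∣
  ... | x , x∈p = Fin.suc x , there x∈p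

  card-⊥ : ∀ {m} → card (⊥ₛ {m}) ≡ 0
  card-⊥ {zero} = refl
  card-⊥ {suc m} = card-⊥ {m}

  card≡0⇒∉ : ∀ {m} (p : Subset m) → card p ≡ 0 → ∀ {x} → x ∉ₛ p
  card≡0⇒∉ (outside ∷ p) ∣p∣≡0 (there x∈p) = card≡0⇒∉ p ∣p∣≡0 x∈p

  disjoint⇒card-∩≡0 : ∀ {m} (p q : Subset m) → (∀ {x} → x ∈ₛ p → x ∉ₛ q) → card (p ∩ q) ≡ 0
  disjoint⇒card-∩≡0 p q disjoint with card (p ∩ q) in ∣p∩q∣
  ... | zero = refl
  ... | suc _ with card>0⇒nonempty (p ∩ q) (subst (1 ≤_) (sym ∣p∩q∣) (s≤s z≤n))
  ...   | x , x∈p∩q = let (x∈p , x∈q) = x∈p∩q⁻ p q x∈p∩q in ⊥-elim (disjoint x∈p x∈q)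

  card-remove : ∀ {m} {x : Fin m} (p : Subset m) → x ∈ₛ p → card p ≡ suc (card (p - x))
  card-remove (inside ∷ p) here = cong (suc ∘ card) (sym (p─⊥≡p p))
  card-remove (inside ∷ p) (there x∈p) = cong suc (card-remove p x∈p)
  card-remove (outside ∷ p) (there x∈p) = card-remove p x∈p

  card-insert : ∀ {m} {x : Fin m} (p : Subset m) → x ∉ₛ p → card (⁅ x ⁆ ∪ p) ≡ suc (card p)
  card-insert {x = Fin.zero} (inside ∷ p) x∉p = ⊥-elim (x∉p here)
  card-insert {x = Fin.zero} (outside ∷ p) _ = cong (suc ∘ card) (∪-identityˡ p)
  card-insert {x = Fin.suc x} (inside ∷ p) x∉p = cong suc (card-insert p (x∉p ∘ there))
  card-insert {x = Fin.suc x} (outside ∷ p) x∉p = card-insert p (x∉p ∘ there)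

  ⊆-of-size : ∀ {m} (p : Subset m) k → k ≤ card p → ∃ λ q → q ⊆ p × card q ≡ k
  ⊆-of-size {m} p zero _ = ⊥ₛ , ⊥⊆ , card-⊥ {m}
  ⊆-of-size (inside ∷ p) (suc k) (s≤s k≤∣p∣) =
    let (q , q⊆p , ∣q∣) = ⊆-of-size p k k≤∣p∣ in inside ∷ q , s⊆s q⊆p , cong suc ∣q∣
  ⊆-of-size (outside ∷ p) (suc k) k<∣p∣ =
    let (q , q⊆p , ∣q∣) = ⊆-of-size p (suc k) k<∣p∣ in outside ∷ q , out⊆ q⊆p , ∣q∣

  ─-involutive : ∀ {m} (p q : Subset m) → q ⊆ p → p ─ (p ─ q) ≡ q
  ─-involutive p q q⊆p = ⊆-antisym to from
    where
    to : p ─ (p ─ q) ⊆ q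
    to {x} x∈ with x ∈? q
    ... | yes x∈q = x∈q
    ... | no x∉q = ⊥-elim (x∈p─q⇒x∉q p (p ─ q) x∈ (x∈p∧x∉q⇒x∈p─q (p─q⊆p p (p ─ q) x∈) x∉q))
    from : q ⊆ p ─ (p ─ q)
    from x∈q = x∈p∧x∉q⇒x∈p─q (q⊆p x∈q) (λ x∈p─q → x∈p─q⇒x∉q p q x∈p─q x∈q)

  x∈p-y⁻ : ∀ {m} {x y : Fin m} (p : Subset m) → x ∈ₛ p - y → x ∈ₛ p × x ≢ y
  x∈p-y⁻ p x∈ = p─q⊆p p _ x∈ , x∉⁅y⁆⇒x≢y (x∈p─q⇒x∉q p _ x∈)

  p-x≢p-y : ∀ {m} {x y : Fin m} (p : Subset m) → y ∈ₛ p → x ≢ y → p - x ≢ p - y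
  p-x≢p-y p y∈p x≢y p-x≡p-y =
    x∈p─q⇒x∉q p _ (subst (_ ∈ₛ_) p-x≡p-y (x∈p∧x≢y⇒x∈p-y y∈p (x≢y ∘ sym))) (x∈⁅x⁆ _)

  one-of-three-avoids : ∀ {A : Set} → DecidableEquality A → ∀ {Q : A → Set} {a b c : A} →
    a ≢ b → a ≢ c → b ≢ c → Q a → Q b → Q c → ∀ u v → ∃ λ x → Q x × x ≢ u × x ≢ v
  one-of-three-avoids _≟_ {a = a} {b} {c} a≢b a≢c b≢c Qa Qb Qc u v with a ≟ u | a ≟ v
  ... | no a≢u | no a≢v = a , Qa , a≢u , a≢v
  ... | yes refl | _ with b ≟ v
  ...   | no b≢v = b , Qb , a≢b ∘ sym , b≢v
  ...   | yes refl = c , Qc , a≢c ∘ sym , b≢c ∘ sym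
  one-of-three-avoids _≟_ {a = a} {b} {c} a≢b a≢c b≢c Qa Qb Qc u v | no a≢u | yes refl with b ≟ u
  ... | no b≢u = b , Qb , b≢u , a≢b ∘ sym
  ... | yes refl = c , Qc , b≢c ∘ sym , a≢c ∘ sym

  choose-element : ∀ {m} (p : Subset m) {k} → card p ≡ suc k → ∃ λ x → x ∈ₛ p × card (p - x) ≡ k
  choose-element p ∣p∣ with card>0⇒nonempty p (subst (1 ≤_) (sym ∣p∣) (s≤s z≤n))
  ... | x , x∈p = x , x∈p , ℕP.suc-injective (trans (sym (card-remove p x∈p)) ∣p∣)

  record ThreeElements {m} (p : Subset m) : Set where
    field
      x₁ x₂ x₃ : Fin m
      x₁∈ : x₁ ∈ₛ p
      x₂∈ : x₂ ∈ₛ p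
      x₃∈ : x₃ ∈ₛ p
      x₁≢x₂ : x₁ ≢ x₂
      x₁≢x₃ : x₁ ≢ x₃
      x₂≢x₃ : x₂ ≢ x₃

  three-elements : ∀ {m} (p : Subset m) {k} → card p ≡ 3 + k → ThreeElements p
  three-elements p ∣p∣ with choose-element p ∣p∣
  ... | x₁ , x₁∈ , ∣p₁∣ with choose-element (p - x₁) ∣p₁∣
  ...   | x₂ , x₂∈′ , ∣p₂∣ with choose-element (p - x₁ - x₂) ∣p₂∣
  ...     | x₃ , x₃∈″ , _ =
    let (x₂∈ , x₂≢x₁) = x∈p-y⁻ p x₂∈′
        (x₃∈′ , x₃≢x₂) = x∈p-y⁻ (p - x₁) x₃∈″
        (x₃∈ , x₃≢x₁) = x∈p-y⁻ p x₃∈′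
    in record { x₁∈ = x₁∈ ; x₂∈ = x₂∈ ; x₃∈ = x₃∈
              ; x₁≢x₂ = x₂≢x₁ ∘ sym ; x₁≢x₃ = x₃≢x₁ ∘ sym ; x₂≢x₃ = x₃≢x₂ ∘ sym }

  -- Opaque: conversion checks that unfold this proof are prohibitively expensive.
  opaque
    ⊆-avoiding-two : ∀ {m} (W : Subset m) k → suc k ≤ card W → 2 ≤ k → ∀ F₁ F₂ →
                     ∃ λ B → (B ⊆ W × card B ≡ k) × B ≢ F₁ × B ≢ F₂
    ⊆-avoiding-two W 1 _ (s≤s ()) _ _
    ⊆-avoiding-two W k@(suc (suc _)) k<∣W∣ _ F₁ F₂ with ⊆-of-size W (suc k) k<∣W∣
    ... | W′ , W′⊆W , ∣W′∣ =
      one-of-three-avoids subset-≟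
        (p-x≢p-y W′ x₂∈ x₁≢x₂) (p-x≢p-y W′ x₃∈ x₁≢x₃) (p-x≢p-y W′ x₃∈ x₂≢x₃)
        (removal x₁∈) (removal x₂∈) (removal x₃∈) F₁ F₂
      where
      open ThreeElements (three-elements W′ ∣W′∣)
      removal : ∀ {x} → x ∈ₛ W′ → W′ - x ⊆ W × card (W′ - x) ≡ k
      removal x∈ = ⊆-trans (p─q⊆p W′ _) W′⊆W , ℕP.suc-injective (trans (sym (card-remove W′ x∈)) ∣W′∣)

  card-─-∩ : ∀ {m} (p q : Subset m) → card (p ─ q) + card (p ∩ q) ≡ card p
  card-─-∩ [] [] = refl
  card-─-∩ (inside ∷ p) (inside ∷ q) = trans (ℕP.+-suc (card (p ─ q)) (card (p ∩ q))) (cong suc (card-─-∩ p q))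
  card-─-∩ (inside ∷ p) (outside ∷ q) = cong suc (card-─-∩ p q)
  card-─-∩ (outside ∷ p) (inside ∷ q) = card-─-∩ p q
  card-─-∩ (outside ∷ p) (outside ∷ q) = card-─-∩ p q

  x∉p⇒p-x≡p : ∀ {m} {x : Fin m} (p : Subset m) → x ∉ₛ p → p - x ≡ p
  x∉p⇒p-x≡p {x = x} p x∉p = ⊆-antisym (p─q⊆p p ⁅ x ⁆) (λ y∈p → x∈p∧x≢y⇒x∈p-y y∈p (λ { refl → x∉p y∈p }))

  card≤1+card-remove : ∀ {m} (p : Subset m) x → card p ≤ suc (card (p - x))
  card≤1+card-remove p x with x ∈? p
  ... | yes x∈p = ℕP.≤-reflexive (card-remove p x∈p)
  ... | no x∉p = ℕP.m≤n⇒m≤1+n (ℕP.≤-reflexive (cong card (sym (x∉p⇒p-x≡p p x∉p))))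

  countᵇ : ∀ {A : Set} → (A → Bool) → List A → ℕ
  countᵇ p [] = 0
  countᵇ p (x ∷ xs) = if p x then suc (countᵇ p xs) else countᵇ p xs

  module _ {A : Set} where

    length-filter : ∀ {P : A → Set} (P? : Decidable P) xs → length (filter P? xs) ≡ countᵇ (does ∘ P?) xs
    length-filter P? [] = refl
    length-filter P? (x ∷ xs) with does (P? x)
    ... | true = cong suc (length-filter P? xs)
    ... | false = length-filter P? xs

    countᵇ-++ : ∀ (p : A → Bool) xs ys → countᵇ p (xs ++ ys) ≡ countᵇ p xs + countᵇ p ys
    countᵇ-++ p [] ys = refl
    countᵇ-++ p (x ∷ xs) ys with p x
    ... | true = cong suc (countᵇ-++ p xs ys)
    ... | false = countᵇ-++ p xs ys

    countᵇ-map : ∀ {B : Set} (p : B → Bool) (f : A → B) xs → countᵇ p (map f xs) ≡ countᵇ (p ∘ f) xs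
    countᵇ-map p f [] = refl
    countᵇ-map p f (x ∷ xs) with p (f x)
    ... | true = cong suc (countᵇ-map p f xs)
    ... | false = countᵇ-map p f xs

    countᵇ-cong : ∀ (p q : A → Bool) xs → (∀ x → p x ≡ q x) → countᵇ p xs ≡ countᵇ q xs
    countᵇ-cong p q [] _ = refl
    countᵇ-cong p q (x ∷ xs) p≗q rewrite p≗q x with q x
    ... | true = cong suc (countᵇ-cong p q xs p≗q)
    ... | false = countᵇ-cong p q xs p≗q

    countᵇ-false : ∀ xs → countᵇ (λ (_ : A) → false) xs ≡ 0
    countᵇ-false [] = refl
    countᵇ-false (_ ∷ xs) = countᵇ-false xs

    countᵇ-filter : ∀ {P : A → Set} (P? : Decidable P) (q : A → Bool) xs →
                    countᵇ q (filter P? xs) ≡ countᵇ (λ x → q x ∧ does (P? x)) xs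
    countᵇ-filter P? q [] = refl
    countᵇ-filter P? q (x ∷ xs) with does (P? x)
    ... | true with q x
    ...   | true = cong suc (countᵇ-filter P? q xs)
    ...   | false = countᵇ-filter P? q xs
    countᵇ-filter P? q (x ∷ xs) | false with q x
    ...   | true = countᵇ-filter P? q xs
    ...   | false = countᵇ-filter P? q xs

  countᵇ-subsets : ∀ {m} (T : Subset m) k →
    countᵇ (λ A → does (A ⊆? T) ∧ does (card A ℕP.≟ k)) (allSubsets m) ≡ card T C k
  countᵇ-subsets [] zero = refl
  countᵇ-subsets [] (suc k) = refl
  countᵇ-subsets {suc m} (t ∷ T) k = begin
    countᵇ p (map (true ∷_) (allSubsets m) ++ map (false ∷_) (allSubsets m))
      ≡⟨ countᵇ-++ p (map (true ∷_) (allSubsets m)) (map (false ∷_) (allSubsets m)) ⟩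
    countᵇ p (map (true ∷_) (allSubsets m)) + countᵇ p (map (false ∷_) (allSubsets m))
      ≡⟨ cong₂ _+_ (countᵇ-map p (true ∷_) (allSubsets m)) (countᵇ-map p (false ∷_) (allSubsets m)) ⟩
    countᵇ (p ∘ (true ∷_)) (allSubsets m) + countᵇ (p ∘ (false ∷_)) (allSubsets m)
      ≡⟨ split t k ⟩
    card (t ∷ T) C k ∎
    where
    open ≡-Reasoning
    p = λ (A : Subset (suc m)) → does (A ⊆? (t ∷ T)) ∧ does (card A ℕP.≟ k)
    rest : ℕ → ℕ
    rest k = countᵇ (λ A → does (A ⊆? T) ∧ does (card A ℕP.≟ k)) (allSubsets m)
    split : ∀ t k → countᵇ (λ A → does ((true ∷ A) ⊆? (t ∷ T)) ∧ does (suc (card A) ℕP.≟ k)) (allSubsets m)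
                  + countᵇ (λ A → does (A ⊆? T) ∧ does (card A ℕP.≟ k)) (allSubsets m) ≡ card (t ∷ T) C k
    split outside k = trans (cong (_+ rest k) (countᵇ-false (allSubsets m))) (countᵇ-subsets T k)
    split inside zero = trans (cong (_+ rest zero) noneWithHead) (countᵇ-subsets T zero)
      where
      noneWithHead : countᵇ (λ A → does (A ⊆? T) ∧ false) (allSubsets m) ≡ 0
      noneWithHead = trans (countᵇ-cong _ (λ _ → false) (allSubsets m) (λ A → BoolP.∧-zeroʳ (does (A ⊆? T))))
                           (countᵇ-false (allSubsets m))
    split inside (suc k) =
      trans (cong₂ _+_ (countᵇ-subsets T k) (countᵇ-subsets T (suc k))) (nCk+nC[k+1]≡[n+1]C[k+1] (card T) k)

  length-⊆-F : ∀ k m (T : Subset m) → length (filter (_⊆? T) (F k m)) ≡ card T C k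
  length-⊆-F k m T = begin
    length (filter (_⊆? T) (F k m))
      ≡⟨ length-filter (_⊆? T) (F k m) ⟩
    countᵇ (does ∘ (_⊆? T)) (F k m)
      ≡⟨ countᵇ-filter (λ A → card A ℕP.≟ k) (does ∘ (_⊆? T)) (allSubsets m) ⟩
    countᵇ (λ A → does (A ⊆? T) ∧ does (card A ℕP.≟ k)) (allSubsets m)
      ≡⟨ countᵇ-subsets T k ⟩
    card T C k ∎
    where open ≡-Reasoning

  card-⊤ : ∀ m → card (⊤ₛ {m}) ≡ m
  card-⊤ zero = refl
  card-⊤ (suc m) = cong suc (card-⊤ m)

  length-F : ∀ k m → length (F k m) ≡ m C k
  length-F k m = begin
    length (F k m)                   ≡⟨ cong length (sym (ListP.filter-all (_⊆? ⊤ₛ) everyA⊆⊤)) ⟩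
    length (filter (_⊆? ⊤ₛ) (F k m)) ≡⟨ length-⊆-F k m ⊤ₛ ⟩
    card (⊤ₛ {m}) C k                ≡⟨ cong (_C k) (card-⊤ m) ⟩
    m C k                           ∎
    where
    open ≡-Reasoning
    everyA⊆⊤ : All (_⊆ ⊤ₛ) (F k m)
    everyA⊆⊤ = All.universal (λ _ {x} → ⊆⊤ {x = x}) (F k m)

  ∈-allSubsets : ∀ {m} (A : Subset m) → A ∈ allSubsets m
  ∈-allSubsets [] = here refl
  ∈-allSubsets {suc m} (true ∷ A) = ∈-++⁺ˡ (∈-map⁺ (true ∷_) (∈-allSubsets A))
  ∈-allSubsets {suc m} (false ∷ A) = ∈-++⁺ʳ (map (true ∷_) (allSubsets m)) (∈-map⁺ (false ∷_) (∈-allSubsets A))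

  allSubsets-unique : ∀ m → Unique (allSubsets m)
  allSubsets-unique zero = All.[] ∷ []
  allSubsets-unique (suc m) =
    Unique.++⁺ (Unique.map⁺ ∷-injectiveʳ (allSubsets-unique m)) (Unique.map⁺ ∷-injectiveʳ (allSubsets-unique m))
               disjoint
    where
    disjoint : ∀ {A} → ¬ (A ∈ map (true ∷_) (allSubsets m) × A ∈ map (false ∷_) (allSubsets m))
    disjoint (∈true , ∈false) with ∈-map⁻ (true ∷_) ∈true | ∈-map⁻ (false ∷_) ∈false
    ... | _ , _ , refl | _ , _ , ()

  ∈-F : ∀ {n m} {A : Subset m} → card A ≡ n → A ∈ F n m
  ∈-F {n} {A = A} ∣A∣ = ∈-filter⁺ (λ A → card A ℕP.≟ n) (∈-allSubsets A) ∣A∣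

  F-card : ∀ {n m} {A : Subset m} → A ∈ F n m → card A ≡ n
  F-card {n} {m} A∈ = proj₂ (∈-filter⁻ (λ A → card A ℕP.≟ n) {xs = allSubsets m} A∈)

  F-unique : ∀ n m → Unique (F n m)
  F-unique n m = Unique.filter⁺ (λ A → card A ℕP.≟ n) (allSubsets-unique m)

  C-positive : ∀ a k → k ≤ a → 1 ≤ a C k
  C-positive a zero _ = s≤s z≤n
  C-positive (suc a) (suc k) (s≤s k≤a) =
    subst (1 ≤_) (nCk+nC[k+1]≡[n+1]C[k+1] a k) (ℕP.≤-trans (C-positive a k k≤a) (ℕP.m≤m+n (a C k) (a C suc k)))

  -- The left side is p + 1 for the dimension p of the theorem; the right side counts the complementary
  -- pairs of n-subsets of a 2n-set by their member avoiding a fixed point.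
  central-binomial-half : ∀ n′ → suc (((2 * suc n′) C suc n′) / 2 ∸ 1) ≡ (n′ + suc n′) C suc n′
  central-binomial-half n′ = begin
    suc (((2 * suc n′) C suc n′) / 2 ∸ 1) ≡⟨ cong (λ x → suc (x / 2 ∸ 1)) doubled ⟩
    suc ((c * 2) / 2 ∸ 1)                 ≡⟨ cong (λ x → suc (x ∸ 1)) (m*n/n≡m c 2) ⟩
    suc (c ∸ 1)                           ≡⟨ ℕP.+-comm 1 (c ∸ 1) ⟩
    c ∸ 1 + 1                             ≡⟨ ℕP.m∸n+n≡m (C-positive a (suc n′) (ℕP.m≤n+m (suc n′) n′)) ⟩
    c                                     ∎
    where
    open ≡-Reasoning
    a = n′ + suc n′
    c = a C suc n′
    symmetric : a C n′ ≡ c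
    symmetric = trans (nCk≡nC[n∸k] (ℕP.m≤m+n n′ (suc n′))) (cong (a C_) (ℕP.m+n∸m≡n n′ (suc n′)))
    doubled : (2 * suc n′) C suc n′ ≡ c * 2
    doubled = begin
      (2 * suc n′) C suc n′ ≡⟨ cong (λ x → suc (n′ + x) C suc n′) (ℕP.+-identityʳ (suc n′)) ⟩
      suc a C suc n′        ≡⟨ sym (nCk+nC[k+1]≡[n+1]C[k+1] a n′) ⟩
      a C n′ + c            ≡⟨ cong (_+ c) symmetric ⟩
      c + c                 ≡⟨ cong (c +_) (sym (ℕP.+-identityʳ c)) ⟩
      2 * c                 ≡⟨ ℕP.*-comm 2 c ⟩
      c * 2                 ∎

  -- The choices that determine the marked facet of the sphere on S. The third n′-subset H of R, besides
  -- P and R ─ P, exists only for n′ ≥ 2, that is n ≥ 3.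
  record Split {m : ℕ} (n′ : ℕ) (S : Subset m) : Set where
    field
      s₁ s₂ : Fin m
      s₁∈S : s₁ ∈ₛ S
      s₂∈S-s₁ : s₂ ∈ₛ S - s₁
      P : Subset m
      P⊆R : P ⊆ S - s₁ - s₂
      ∣P∣ : card P ≡ n′
      H : Subset m
      H⊆R : H ⊆ S - s₁ - s₂
      ∣H∣ : card H ≡ n′
      H≢P : H ≢ P
      H≢R─P : H ≢ (S - s₁ - s₂) ─ P

  1+n≤n+n : ∀ {n′} → 2 ≤ n′ → suc n′ ≤ n′ + n′
  1+n≤n+n {n′} 2≤n′ = subst (_≤ n′ + n′) (ℕP.+-comm n′ 1) (ℕP.+-monoʳ-≤ n′ (ℕP.≤-trans (s≤s z≤n) 2≤n′))

  split : ∀ {m} n′ → 2 ≤ n′ → (S : Subset m) → card S ≡ suc n′ + suc n′ → Split n′ S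
  split n′ 2≤n′ S ∣S∣ with choose-element S ∣S∣
  ... | s₁ , s₁∈S , ∣S-s₁∣ with choose-element (S - s₁) (trans ∣S-s₁∣ (ℕP.+-suc n′ n′))
  ...   | s₂ , s₂∈ , ∣R∣ with ⊆-of-size (S - s₁ - s₂) n′ (subst (n′ ≤_) (sym ∣R∣) (ℕP.m≤m+n n′ n′))
  ...     | P , P⊆R , ∣P∣
    with ⊆-avoiding-two (S - s₁ - s₂) n′ (subst (suc n′ ≤_) (sym ∣R∣) (1+n≤n+n 2≤n′)) 2≤n′ P (S - s₁ - s₂ ─ P)
  ...       | H , (H⊆R , ∣H∣) , H≢P , H≢R─P = record
    { s₁∈S = s₁∈S ; s₂∈S-s₁ = s₂∈ ; P⊆R = P⊆R ; ∣P∣ = ∣P∣ ; H⊆R = H⊆R ; ∣H∣ = ∣H∣ ; H≢P = H≢P ; H≢R─P = H≢R─P }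

  module SphereOf {m : ℕ} (n′ : ℕ) (S : Subset m) (∣S∣ : card S ≡ suc n′ + suc n′)
                   (sp : Split n′ S) where

    open Split sp

    n : ℕ
    n = suc n′

    complement-card : ∀ {A} → A ⊆ S → card A ≡ n → card (S ─ A) ≡ n
    complement-card {A} A⊆S ∣A∣ =
      ℕP.+-cancelʳ-≡ n (card (S ─ A)) n (trans (subst (λ k → card (S ─ A) + k ≡ card S) ∣A∣ (card-─ S A A⊆S)) ∣S∣)

    ∣S-s₁∣ : card (S - s₁) ≡ n′ + n
    ∣S-s₁∣ = ℕP.suc-injective (trans (sym (card-remove S s₁∈S)) ∣S∣)

    R : Subset m
    R = S - s₁ - s₂

    ∣R∣ : card R ≡ n′ + n′
    ∣R∣ = ℕP.suc-injective (trans (sym (card-remove (S - s₁) s₂∈S-s₁)) (trans ∣S-s₁∣ (ℕP.+-suc n′ n′)))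

    Q : Subset m
    Q = R ─ P

    Q⊆R : Q ⊆ R
    Q⊆R = p─q⊆p R P

    ∣Q∣ : card Q ≡ n′
    ∣Q∣ = ℕP.+-cancelʳ-≡ n′ (card Q) n′ (trans (subst (λ k → card Q + k ≡ card R) ∣P∣ (card-─ R P P⊆R)) ∣R∣)

    R─Q≡P : R ─ Q ≡ P
    R─Q≡P = ─-involutive R P P⊆R

    s₂∈S : s₂ ∈ₛ S
    s₂∈S = p─q⊆p S _ s₂∈S-s₁

    s₂≢s₁ : s₂ ≢ s₁
    s₂≢s₁ = proj₂ (x∈p-y⁻ S s₂∈S-s₁)

    R⊆S : R ⊆ S
    R⊆S = p─q⊆p S _ ∘ p─q⊆p (S - s₁) _

    s₁∉R : s₁ ∉ₛ R
    s₁∉R s₁∈R = proj₂ (x∈p-y⁻ S (p─q⊆p (S - s₁) _ s₁∈R)) refl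

    s₂∉R : s₂ ∉ₛ R
    s₂∉R s₂∈R = proj₂ (x∈p-y⁻ (S - s₁) s₂∈R) refl

    ∈R : ∀ {x} → x ∈ₛ S → x ≢ s₁ → x ≢ s₂ → x ∈ₛ R
    ∈R x∈S x≢s₁ x≢s₂ = x∈p∧x≢y⇒x∈p-y (x∈p∧x≢y⇒x∈p-y x∈S x≢s₁) x≢s₂

    isHalf : Subset m → Bool
    isHalf H = does (subset-≟ H P) ∨ does (subset-≟ H Q)

    -- A chosen set contains s₁ exactly when it meets R in P or in Q.
    chosen : Subset m → Bool
    chosen A = does (A ⊆? S) ∧ (not (does (s₁ ∈? A)) xor isHalf (A ∩ R))

    chosen⇒⊆ : ∀ {A} → chosen A ≡ true → A ⊆ S
    chosen⇒⊆ {A} chosenA with A ⊆? S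
    ... | yes A⊆S = A⊆S

    chosen-⊆ : ∀ {A} → A ⊆ S → chosen A ≡ (not (does (s₁ ∈? A)) xor isHalf (A ∩ R))
    chosen-⊆ {A} A⊆S = cong (_∧ (not (does (s₁ ∈? A)) xor isHalf (A ∩ R))) (dec-true (A ⊆? S) A⊆S)

    isHalf-true : ∀ H → isHalf H ≡ true → H ≡ P ⊎ H ≡ Q
    isHalf-true H half with subset-≟ H P | subset-≟ H Q
    ... | yes H≡P | _ = inj₁ H≡P
    ... | no _ | yes H≡Q = inj₂ H≡Q

    isHalf-card : ∀ H → card H ≢ n′ → isHalf H ≡ false
    isHalf-card H ∣H∣≢n′ = cong₂ _∨_ (dec-false (subset-≟ H P) (λ { refl → ∣H∣≢n′ ∣P∣ }))
                                       (dec-false (subset-≟ H Q) (λ { refl → ∣H∣≢n′ ∣Q∣ }))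

    isHalf-─ : ∀ {H} → H ⊆ R → isHalf (R ─ H) ≡ isHalf H
    isHalf-─ {H} H⊆R = trans (cong₂ _∨_ toQ toP) (BoolP.∨-comm (does (subset-≟ H Q)) (does (subset-≟ H P)))
      where
      toQ : does (subset-≟ (R ─ H) P) ≡ does (subset-≟ H Q)
      toQ = does-⇔ (mk⇔ (λ R─H≡P → trans (sym (─-involutive R H H⊆R)) (cong (R ─_) R─H≡P))
                        (λ H≡Q → trans (cong (R ─_) H≡Q) R─Q≡P))
                   (subset-≟ (R ─ H) P) (subset-≟ H Q)
      toP : does (subset-≟ (R ─ H) Q) ≡ does (subset-≟ H P)
      toP = does-⇔ (mk⇔ (λ R─H≡Q → trans (sym (─-involutive R H H⊆R)) (trans (cong (R ─_) R─H≡Q) R─Q≡P))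
                        (cong (R ─_)))
                   (subset-≟ (R ─ H) Q) (subset-≟ H P)

    ─-∩R : ∀ A → (S ─ A) ∩ R ≡ R ─ (A ∩ R)
    ─-∩R A = ⊆-antisym to from
      where
      to : (S ─ A) ∩ R ⊆ R ─ (A ∩ R)
      to x∈ = let (x∈S─A , x∈R) = x∈p∩q⁻ (S ─ A) R x∈ in
        x∈p∧x∉q⇒x∈p─q x∈R (x∈p─q⇒x∉q S A x∈S─A ∘ p∩q⊆p A R)
      from : R ─ (A ∩ R) ⊆ (S ─ A) ∩ R
      from x∈ = let x∈R = p─q⊆p R _ x∈ in
        x∈p∩q⁺ (x∈p∧x∉q⇒x∈p─q (R⊆S x∈R) (λ x∈A → x∈p─q⇒x∉q R (A ∩ R) x∈ (x∈p∩q⁺ (x∈A , x∈R))) , x∈R)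

    chosen-complement : ∀ {A} → A ⊆ S → chosen (S ─ A) ≡ not (chosen A)
    chosen-complement {A} A⊆S = begin
      chosen (S ─ A)
        ≡⟨ chosen-⊆ (p─q⊆p S A) ⟩
      not (does (s₁ ∈? (S ─ A))) xor isHalf ((S ─ A) ∩ R)
        ≡⟨ cong₂ (λ b c → not b xor c) s₁∈complement (trans (cong isHalf (─-∩R A)) (isHalf-─ (p∩q⊆q A R))) ⟩
      not (not (does (s₁ ∈? A))) xor isHalf (A ∩ R)
        ≡⟨ not-not-xor (does (s₁ ∈? A)) (isHalf (A ∩ R)) ⟩
      not (not (does (s₁ ∈? A)) xor isHalf (A ∩ R))
        ≡⟨ cong not (sym (chosen-⊆ A⊆S)) ⟩
      not (chosen A) ∎
      where
      open ≡-Reasoning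
      s₁∈complement : does (s₁ ∈? (S ─ A)) ≡ not (does (s₁ ∈? A))
      s₁∈complement with s₁ ∈? A
      ... | yes s₁∈A = dec-false (s₁ ∈? (S ─ A)) (λ s₁∈ → x∈p─q⇒x∉q S A s₁∈ s₁∈A)
      ... | no s₁∉A = dec-true (s₁ ∈? (S ─ A)) (x∈p∧x∉q⇒x∈p─q s₁∈S s₁∉A)
      not-not-xor : ∀ a b → not (not a) xor b ≡ not (not a xor b)
      not-not-xor false false = refl
      not-not-xor false true = refl
      not-not-xor true false = refl
      not-not-xor true true = refl

    chosen-without-s₁ : ∀ {A} → A ⊆ S → s₁ ∉ₛ A → isHalf (A ∩ R) ≡ false → chosen A ≡ true
    chosen-without-s₁ {A} A⊆S s₁∉A notHalf =
      trans (chosen-⊆ A⊆S) (cong₂ (λ b c → not b xor c) (dec-false (s₁ ∈? A) s₁∉A) notHalf)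

    insert-∩R : ∀ {s H} → s ∉ₛ R → H ⊆ R → (⁅ s ⁆ ∪ H) ∩ R ≡ H
    insert-∩R {s} {H} s∉R H⊆R = ⊆-antisym to (λ x∈H → x∈p∩q⁺ (x∈p∪q⁺ (inj₂ x∈H) , H⊆R x∈H))
      where
      to : (⁅ s ⁆ ∪ H) ∩ R ⊆ H
      to x∈ with x∈p∩q⁻ (⁅ s ⁆ ∪ H) R x∈
      ... | x∈s∪H , x∈R with x∈p∪q⁻ ⁅ s ⁆ H x∈s∪H
      ...   | inj₁ x∈s = ⊥-elim (s∉R (subst (_∈ₛ R) (x∈⁅y⁆⇒x≡y s x∈s) x∈R))
      ...   | inj₂ x∈H = x∈H

    insert-⊆S : ∀ {s H} → s ∈ₛ S → H ⊆ R → ⁅ s ⁆ ∪ H ⊆ S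
    insert-⊆S {s} {H} s∈S H⊆R x∈ with x∈p∪q⁻ ⁅ s ⁆ H x∈
    ... | inj₁ x∈s = subst (_∈ₛ S) (sym (x∈⁅y⁆⇒x≡y s x∈s)) s∈S
    ... | inj₂ x∈H = R⊆S (H⊆R x∈H)

    insert-card : ∀ {s H} → s ∉ₛ R → H ⊆ R → card H ≡ n′ → card (⁅ s ⁆ ∪ H) ≡ n
    insert-card s∉R H⊆R ∣H∣ = trans (card-insert _ (s∉R ∘ H⊆R)) (cong suc ∣H∣)

    chosen-with-s₁ : ∀ {H} → H ⊆ R → isHalf H ≡ true → chosen (⁅ s₁ ⁆ ∪ H) ≡ true
    chosen-with-s₁ {H} H⊆R half = trans (chosen-⊆ (insert-⊆S s₁∈S H⊆R))
      (cong₂ (λ b c → not b xor c) (dec-true (s₁ ∈? (⁅ s₁ ⁆ ∪ H)) (x∈p∪q⁺ (inj₁ (x∈⁅x⁆ s₁))))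
                                   (trans (cong isHalf (insert-∩R s₁∉R H⊆R)) half))

    isHalf⇒card : ∀ H → isHalf H ≡ true → card H ≡ n′
    isHalf⇒card H half with isHalf-true H half
    ... | inj₁ H≡P = trans (cong card H≡P) ∣P∣
    ... | inj₂ H≡Q = trans (cong card H≡Q) ∣Q∣

    chosen-inside : ∀ {W} → W ⊆ S → card W ≡ suc n → ∃ λ B → B ⊆ W × card B ≡ n × chosen B ≡ true
    chosen-inside {W} W⊆S ∣W∣ with s₁ ∈? W
    ... | no s₁∉W = B , B⊆W , ∣B∣ , chosen-without-s₁ (W⊆S ∘ B⊆W) (s₁∉W ∘ B⊆W) (isHalf-card (B ∩ R) ∣B∩R∣≢n′)
      where
      bigEnough : n ≤ card (W - s₂)
      bigEnough = ℕP.≤-pred (subst (_≤ suc (card (W - s₂))) ∣W∣ (card≤1+card-remove W s₂))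
      B = proj₁ (⊆-of-size (W - s₂) n bigEnough)
      B⊆W-s₂ : B ⊆ W - s₂
      B⊆W-s₂ = proj₁ (proj₂ (⊆-of-size (W - s₂) n bigEnough))
      ∣B∣ : card B ≡ n
      ∣B∣ = proj₂ (proj₂ (⊆-of-size (W - s₂) n bigEnough))
      B⊆W : B ⊆ W
      B⊆W = p─q⊆p W _ ∘ B⊆W-s₂
      B⊆R : B ⊆ R
      B⊆R x∈B = let (x∈W , x≢s₂) = x∈p-y⁻ W (B⊆W-s₂ x∈B) in ∈R (W⊆S x∈W) (λ { refl → s₁∉W x∈W }) x≢s₂
      B∩R≡B : B ∩ R ≡ B
      B∩R≡B = ⊆-antisym (p∩q⊆p B R) (λ x∈B → x∈p∩q⁺ (x∈B , B⊆R x∈B))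
      ∣B∩R∣≢n′ : card (B ∩ R) ≢ n′
      ∣B∩R∣≢n′ ∣B∩R∣ = ℕP.1+n≢n (trans (sym ∣B∣) (trans (cong card (sym B∩R≡B)) ∣B∩R∣))
    ... | yes s₁∈W with isHalf ((W - s₁) ∩ R) in half
    ...   | false = W - s₁ , p─q⊆p W _ , ℕP.suc-injective (trans (sym (card-remove W s₁∈W)) ∣W∣) ,
                    chosen-without-s₁ (W⊆S ∘ p─q⊆p W _) (λ s₁∈ → proj₂ (x∈p-y⁻ W s₁∈) refl) half
    ...   | true = ⁅ s₁ ⁆ ∪ K , B⊆W , insert-card s₁∉R K⊆R (isHalf⇒card K half) , chosen-with-s₁ K⊆R half
      where
      K = (W - s₁) ∩ R
      K⊆R : K ⊆ R
      K⊆R = p∩q⊆q (W - s₁) R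
      B⊆W : ⁅ s₁ ⁆ ∪ K ⊆ W
      B⊆W x∈ with x∈p∪q⁻ ⁅ s₁ ⁆ K x∈
      ... | inj₁ x∈s₁ = subst (_∈ₛ W) (sym (x∈⁅y⁆⇒x≡y s₁ x∈s₁)) s₁∈W
      ... | inj₂ x∈K = p─q⊆p W _ (p∩q⊆p (W - s₁) R x∈K)

    private
      outside-big : ∀ a c → a + c ≡ n + n → c ≤ n′ → suc n ≤ a
      outside-big a c a+c≡ c≤n′ = ℕP.+-cancelʳ-≤ c (suc n) a (begin
        suc n + c  ≤⟨ ℕP.+-monoʳ-≤ (suc n) c≤n′ ⟩
        suc n + n′ ≡⟨ cong suc (sym (ℕP.+-suc n′ n′)) ⟩
        n + n      ≡⟨ sym a+c≡ ⟩
        a + c      ∎)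
        where open ℕP.≤-Reasoning

    DisjointChosen : Subset m → Set
    DisjointChosen y = ∃ λ B → card B ≡ n × chosen B ≡ true × card (B ∩ y) ≡ 0

    disjointChosen-⊈ : ∀ {y} → card y ≡ n → ¬ y ⊆ S → DisjointChosen y
    disjointChosen-⊈ {y} ∣y∣ y⊈S = B , ∣B∣ , chosenB , disjoint⇒card-∩≡0 B y (x∈p─q⇒x∉q S y ∘ W⊆S─y ∘ B⊆W)
      where
      S∩y≢y : S ∩ y ≢ y
      S∩y≢y S∩y≡y = y⊈S (λ x∈y → p∩q⊆p S y (subst (_ ∈ₛ_) (sym S∩y≡y) x∈y))
      ∣S∩y∣<n : card (S ∩ y) < n
      ∣S∩y∣<n = ℕP.≤∧≢⇒< (subst (card (S ∩ y) ≤_) ∣y∣ (⊆⇒card≤ (p∩q⊆q S y)))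
                         (λ ∣S∩y∣≡n → S∩y≢y (⊆∧card≥⇒≡ (p∩q⊆q S y) (ℕP.≤-reflexive (trans ∣y∣ (sym ∣S∩y∣≡n)))))
      big : suc n ≤ card (S ─ y)
      big = outside-big (card (S ─ y)) (card (S ∩ y)) (trans (card-─-∩ S y) ∣S∣) (ℕP.≤-pred ∣S∩y∣<n)
      W = proj₁ (⊆-of-size (S ─ y) (suc n) big)
      W⊆S─y : W ⊆ S ─ y
      W⊆S─y = proj₁ (proj₂ (⊆-of-size (S ─ y) (suc n) big))
      inside-W = chosen-inside (p─q⊆p S y ∘ W⊆S─y) (proj₂ (proj₂ (⊆-of-size (S ─ y) (suc n) big)))
      B = proj₁ inside-W
      B⊆W : B ⊆ W
      B⊆W = proj₁ (proj₂ inside-W)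
      ∣B∣ : card B ≡ n
      ∣B∣ = proj₁ (proj₂ (proj₂ inside-W))
      chosenB : chosen B ≡ true
      chosenB = proj₂ (proj₂ (proj₂ inside-W))

    disjointChosen : ∀ {y} → card y ≡ n → chosen y ≡ false → DisjointChosen y
    disjointChosen {y} ∣y∣ notChosen = byInclusion (y ⊆? S)
      where
      byInclusion : Dec (y ⊆ S) → DisjointChosen y
      byInclusion (no y⊈S) = disjointChosen-⊈ ∣y∣ y⊈S
      byInclusion (yes y⊆S) = S ─ y , complement-card y⊆S ∣y∣ , trans (chosen-complement y⊆S) (cong not notChosen) ,
                              disjoint⇒card-∩≡0 (S ─ y) y (x∈p─q⇒x∉q S y)

    Covered : Fin m → Set
    Covered t = ∃ λ B → card B ≡ n × chosen B ≡ true × t ∈ₛ B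

    private
      covered-by-half : ∀ {t H} → H ⊆ R → isHalf H ≡ true → t ∈ₛ ⁅ s₁ ⁆ ∪ H → Covered t
      covered-by-half {H = H} H⊆R half t∈ =
        ⁅ s₁ ⁆ ∪ H , insert-card s₁∉R H⊆R (isHalf⇒card H half) , chosen-with-s₁ H⊆R half , t∈

      isHalf-P : isHalf P ≡ true
      isHalf-P = cong (_∨ does (subset-≟ P Q)) (dec-true (subset-≟ P P) refl)

      isHalf-Q : isHalf Q ≡ true
      isHalf-Q = trans (cong (does (subset-≟ Q P) ∨_) (dec-true (subset-≟ Q Q) refl)) (BoolP.∨-zeroʳ _)

    s₂-covered : Covered s₂
    s₂-covered = ⁅ s₂ ⁆ ∪ H , insert-card s₂∉R H⊆R ∣H∣ ,
      chosen-without-s₁ (insert-⊆S s₂∈S H⊆R) s₁∉ (trans (cong isHalf (insert-∩R s₂∉R H⊆R)) notHalf) ,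
      x∈p∪q⁺ (inj₁ (x∈⁅x⁆ s₂))
      where
      s₁∉ : s₁ ∉ₛ ⁅ s₂ ⁆ ∪ H
      s₁∉ s₁∈ with x∈p∪q⁻ ⁅ s₂ ⁆ H s₁∈
      ... | inj₁ s₁∈s₂ = s₂≢s₁ (sym (x∈⁅y⁆⇒x≡y s₂ s₁∈s₂))
      ... | inj₂ s₁∈H = s₁∉R (H⊆R s₁∈H)
      notHalf : isHalf H ≡ false
      notHalf = cong₂ _∨_ (dec-false (subset-≟ H P) H≢P) (dec-false (subset-≟ H Q) H≢R─P)

    covered : ∀ {t} → t ∈ₛ S → Covered t
    covered {t} t∈S with t Fin.≟ s₁ | t Fin.≟ s₂
    ... | yes refl | _ = covered-by-half P⊆R isHalf-P (x∈p∪q⁺ (inj₁ (x∈⁅x⁆ s₁)))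
    ... | no _ | yes refl = s₂-covered
    ... | no t≢s₁ | no t≢s₂ with t ∈? P
    ...   | yes t∈P = covered-by-half P⊆R isHalf-P (x∈p∪q⁺ (inj₂ t∈P))
    ...   | no t∉P = covered-by-half Q⊆R isHalf-Q (x∈p∪q⁺ (inj₂ (x∈p∧x∉q⇒x∈p─q (∈R t∈S t≢s₁ t≢s₂) t∉P)))

    escapes : ∀ {T} → card T ≡ card S → T ≢ S → ∃ λ B → card B ≡ n × chosen B ≡ true × ¬ B ⊆ T
    escapes {T} ∣T∣ T≢S with nonempty? (S ─ T)
    ... | yes (t , t∈S─T) = let (B , ∣B∣ , chosenB , t∈B) = covered (p─q⊆p S T t∈S─T) in
      B , ∣B∣ , chosenB , λ B⊆T → x∈p─q⇒x∉q S T t∈S─T (B⊆T t∈B)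
    ... | no empty = ⊥-elim (T≢S (sym (⊆∧card≥⇒≡ S⊆T (ℕP.≤-reflexive ∣T∣))))
      where
      S⊆T : S ⊆ T
      S⊆T {x} x∈S with x ∈? T
      ... | yes x∈T = x∈T
      ... | no x∉T = ⊥-elim (empty (x , x∈p∧x∉q⇒x∈p─q x∈S x∉T))

    private
      2n′≡n′+n′ : 2 * n′ ≡ n′ + n′
      2n′≡n′+n′ = cong (n′ +_) (ℕP.+-identityʳ n′)

      shared-point-bound : ∀ d c → d + (suc c + suc c) ≡ n + n → d ≤ 2 * n′
      shared-point-bound d c d+2c+2≡ = begin
        d               ≤⟨ ℕP.m≤m+n d (c + c) ⟩
        d + (c + c)     ≡⟨ ℕP.suc-injective (ℕP.suc-injective (begin-equality
          suc (suc (d + (c + c))) ≡⟨ cong suc (sym (ℕP.+-suc d (c + c))) ⟩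
          suc (d + suc (c + c))   ≡⟨ sym (ℕP.+-suc d (suc (c + c))) ⟩
          d + suc (suc (c + c))   ≡⟨ cong (λ k → d + suc k) (sym (ℕP.+-suc c c)) ⟩
          d + (suc c + suc c)     ≡⟨ d+2c+2≡ ⟩
          suc n′ + suc n′         ≡⟨ cong suc (ℕP.+-suc n′ n′) ⟩
          suc (suc (n′ + n′))     ∎)) ⟩
        n′ + n′         ≡⟨ sym 2n′≡n′+n′ ⟩
        2 * n′          ∎
        where open ℕP.≤-Reasoning

    close-unless-complement : ∀ {A B} → A ⊆ S → B ⊆ S → card A ≡ n → card B ≡ n → B ≢ S ─ A →
                              symDiffDist A B ≤ 2 * n′
    close-unless-complement {A} {B} A⊆S B⊆S ∣A∣ ∣B∣ B≢S─A with card (A ∩ B) in ∣A∩B∣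
    ... | zero = ⊥-elim (B≢S─A (⊆∧card≥⇒≡ B⊆S─A (ℕP.≤-reflexive (trans (complement-card A⊆S ∣A∣) (sym ∣B∣)))))
      where
      B⊆S─A : B ⊆ S ─ A
      B⊆S─A x∈B = x∈p∧x∉q⇒x∈p─q (B⊆S x∈B) (λ x∈A → card≡0⇒∉ (A ∩ B) ∣A∩B∣ (x∈p∩q⁺ (x∈A , x∈B)))
    ... | suc c = shared-point-bound (symDiffDist A B) c
      (trans (cong (λ k → symDiffDist A B + (k + k)) (sym ∣A∩B∣))
             (trans (symDiffDist+card-∩ A B) (cong₂ _+_ ∣A∣ ∣B∣)))

    disjoint-far : ∀ (A B : Subset m) → card A ≡ n → card B ≡ n → card (A ∩ B) ≡ 0 →
                   ¬ symDiffDist A B ≤ 2 * n′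
    disjoint-far A B ∣A∣ ∣B∣ ∣A∩B∣ d≤2n′ = ℕP.n≮n (n + n) (begin-strict
      n + n                            ≡⟨ sym (cong₂ _+_ ∣A∣ ∣B∣) ⟩
      card A + card B                  ≡⟨ sym (symDiffDist+card-∩ A B) ⟩
      symDiffDist A B + (card (A ∩ B) + card (A ∩ B)) ≡⟨ cong (λ k → symDiffDist A B + (k + k)) ∣A∩B∣ ⟩
      symDiffDist A B + 0              ≡⟨ ℕP.+-identityʳ _ ⟩
      symDiffDist A B                  ≤⟨ d≤2n′ ⟩
      2 * n′                           ≡⟨ 2n′≡n′+n′ ⟩
      n′ + n′                          <⟨ ℕP.+-mono-< (ℕP.n<1+n n′) (ℕP.n<1+n n′) ⟩
      n + n                            ∎)
      where open ℕP.≤-Reasoning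

    open CrossPolytope subset-≟ (F n m) (F-unique n m)

    representatives : List (Subset m)
    representatives = filter (_⊆? S - s₁) (F n m)

    pairs : List (Subset m × Subset m)
    pairs = pairUp (S ─_) representatives

    length-pairs : length pairs ≡ (n′ + n) C n
    length-pairs = begin
      length pairs                         ≡⟨ ListP.length-map _ representatives ⟩
      length representatives                        ≡⟨ length-⊆-F n m (S - s₁) ⟩
      card (S - s₁) C n                    ≡⟨ cong (_C n) ∣S-s₁∣ ⟩
      (n′ + n) C n                         ∎
      where open ≡-Reasoning

    private
      ∈-representatives⁻ : ∀ {A} → A ∈ representatives → A ∈ F n m × A ⊆ S - s₁
      ∈-representatives⁻ A∈ = ∈-filter⁻ (_⊆? S - s₁) {xs = F n m} A∈

      representative-⊆ : ∀ {A} → A ∈ representatives → A ⊆ S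
      representative-⊆ A∈ x∈A = p─q⊆p S ⁅ s₁ ⁆ (proj₂ (∈-representatives⁻ A∈) x∈A)

      s₁∉representative : ∀ {A} → A ∈ representatives → s₁ ∉ₛ A
      s₁∉representative A∈ s₁∈A = proj₂ (x∈p-y⁻ S (proj₂ (∈-representatives⁻ A∈) s₁∈A)) refl

      s₁∈complement : ∀ {A} → s₁ ∉ₛ A → s₁ ∈ₛ S ─ A
      s₁∈complement = x∈p∧x∉q⇒x∈p─q s₁∈S

    vertex-⊆ : ∀ {y} → y ∈ vertices pairs → y ⊆ S × card y ≡ n
    vertex-⊆ y∈ with ∈-vertices-pairUp⁻ (S ─_) representatives y∈
    ... | A , A∈ , inj₁ refl = representative-⊆ A∈ , F-card (proj₁ (∈-representatives⁻ A∈))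
    ... | A , A∈ , inj₂ refl =
      p─q⊆p S A , complement-card (representative-⊆ A∈) (F-card (proj₁ (∈-representatives⁻ A∈)))

    vertices-unique : Unique (vertices pairs)
    vertices-unique = pairUp-unique (S ─_) representatives (Unique.filter⁺ (_⊆? S - s₁) (F-unique n m))
      (λ A∈ B∈ S─A≡B → s₁∉representative B∈ (subst (s₁ ∈ₛ_) S─A≡B (s₁∈complement (s₁∉representative A∈))))
      (λ {A} {B} A∈ B∈ S─A≡S─B → begin
        A             ≡⟨ sym (─-involutive S A (representative-⊆ A∈)) ⟩
        S ─ (S ─ A)   ≡⟨ cong (S ─_) S─A≡S─B ⟩
        S ─ (S ─ B)   ≡⟨ ─-involutive S B (representative-⊆ B∈) ⟩
        B             ∎)
      where open ≡-Reasoning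

    vertices-⊆F : All (_∈ F n m) (vertices pairs)
    vertices-⊆F = All.tabulate (∈-F ∘ proj₂ ∘ vertex-⊆)

    vertices-close : CrossRelated (λ A B → symDiffDist A B ≤ 2 * n′) pairs
    vertices-close = crossRelated pairs vertices-unique close-to-pair
      where
      close-to-pair : ∀ {a b} → (a , b) ∈ pairs → ∀ {y} → y ∈ vertices pairs → y ≢ a → y ≢ b →
                      symDiffDist a y ≤ 2 * n′ × symDiffDist b y ≤ 2 * n′
      close-to-pair {a} ab∈ y∈ y≢a y≢b with ∈-pairUp⁻ (S ─_) representatives ab∈
      ... | a∈ , refl =
        close-unless-complement a⊆S y⊆S ∣a∣ ∣y∣ y≢b ,
        close-unless-complement (p─q⊆p S a) y⊆S (complement-card a⊆S ∣a∣) ∣y∣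
                                (λ y≡ → y≢a (trans y≡ (─-involutive S a a⊆S)))
        where
        a⊆S = representative-⊆ a∈
        ∣a∣ = F-card (proj₁ (∈-representatives⁻ a∈))
        y⊆S = proj₁ (vertex-⊆ y∈)
        ∣y∣ = proj₂ (vertex-⊆ y∈)

    chosen-complementary : ∀ {A B} → (A , B) ∈ pairs → chosen B ≡ not (chosen A)
    chosen-complementary ab∈ with ∈-pairUp⁻ (S ─_) representatives ab∈
    ... | A∈ , refl = chosen-complement (representative-⊆ A∈)

    chosen⇒vertex : ∀ {y} → y ∈ F n m → chosen y ≡ true → y ∈ vertices pairs
    chosen⇒vertex {y} y∈F chosenY = bySide (s₁ ∈? y)
      where
      y⊆S = chosen⇒⊆ chosenY
      halfVertex : ∀ {A} → A ∈ F n m → A ⊆ S - s₁ → A ∈ vertices pairs × S ─ A ∈ vertices pairs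
      halfVertex A∈F A⊆ = ∈-vertices-pairUp⁺ (S ─_) representatives (∈-filter⁺ (_⊆? S - s₁) A∈F A⊆)
      bySide : Dec (s₁ ∈ₛ y) → y ∈ vertices pairs
      bySide (no s₁∉y) = proj₁ (halfVertex y∈F (λ x∈y → x∈p∧x≢y⇒x∈p-y (y⊆S x∈y) (λ { refl → s₁∉y x∈y })))
      bySide (yes s₁∈y) = subst (_∈ vertices pairs) (─-involutive S y y⊆S)
        (proj₂ (halfVertex (∈-F (complement-card y⊆S (F-card y∈F)))
                           (λ x∈ → x∈p∧x≢y⇒x∈p-y (p─q⊆p S y x∈) (λ { refl → x∈p─q⇒x∉q S y x∈ s₁∈y }))))

  lookup-injective : ∀ {A : Set} {xs : List A} → Unique xs → ∀ i j → lookup xs i ≡ lookup xs j → i ≡ j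
  lookup-injective {xs = x ∷ xs} _ Fin.zero Fin.zero _ = refl
  lookup-injective {xs = x ∷ xs} (x∉ ∷ _) Fin.zero (Fin.suc j) x≡ = ⊥-elim (All.lookup x∉ (∈-lookup j) x≡)
  lookup-injective {xs = x ∷ xs} (x∉ ∷ _) (Fin.suc i) Fin.zero ≡x = ⊥-elim (All.lookup x∉ (∈-lookup i) (sym ≡x))
  lookup-injective {xs = x ∷ xs} (_ ∷ uxs) (Fin.suc i) (Fin.suc j) i≡j =
    cong Fin.suc (lookup-injective uxs i j i≡j)

  module Spheres {m : ℕ} (n′ : ℕ) (2≤n′ : 2 ≤ n′) where

    open VietorisRips subset-≟ symDiffDist (2 * n′) (F (suc n′) m) (F-unique (suc n′) m)

    markedSphere : (S : Subset m) → card S ≡ suc n′ + suc n′ → MarkedSphere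
    markedSphere S ∣S∣ = record
      { pairs = pairs
      ; vertices-unique = vertices-unique
      ; vertices-⊆ = vertices-⊆F
      ; close = vertices-close
      ; chosen = chosen
      ; complementary = chosen-complementary
      ; chosen⇒vertex = chosen⇒vertex
      ; far = λ {y} y∈ notChosen → let (B , ∣B∣ , chosenB , disjoint) = disjointChosen (F-card y∈) notChosen in
                B , ∈-F ∣B∣ , chosenB , disjoint-far B y ∣B∣ (F-card y∈) disjoint
      }
      where open SphereOf n′ S ∣S∣ (split n′ 2≤n′ S ∣S∣)

    length-pairs : ∀ S (∣S∣ : card S ≡ suc n′ + suc n′) →
                   length (MarkedSphere.pairs (markedSphere S ∣S∣)) ≡ (n′ + suc n′) C suc n′
    length-pairs S ∣S∣ = SphereOf.length-pairs n′ S ∣S∣ (split n′ 2≤n′ S ∣S∣)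

    separated : ∀ {S T} (∣S∣ : card S ≡ suc n′ + suc n′) (∣T∣ : card T ≡ suc n′ + suc n′) → T ≢ S →
      ∃ λ B → B ∈ F (suc n′) m × MarkedSphere.chosen (markedSphere S ∣S∣) B ≡ true ×
              B ∉ vertices (MarkedSphere.pairs (markedSphere T ∣T∣))
    separated {S} {T} ∣S∣ ∣T∣ T≢S with SphereOf.escapes n′ S ∣S∣ (split n′ 2≤n′ S ∣S∣) (trans ∣T∣ (sym ∣S∣)) T≢S
    ... | B , ∣B∣ , chosenB , B⊈T =
      B , ∈-F ∣B∣ , chosenB , B⊈T ∘ proj₁ ∘ SphereOf.vertex-⊆ n′ T ∣T∣ (split n′ 2≤n′ T ∣T∣)

open Homology
open SubsetCombinatorics
open import Data.Nat using (_+_; _*_; _∸_; _/_)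
open import Data.Nat.Combinatorics using (_C_)

theorem3p5 : (n m : ℕ) → 3 ≤ n → 2 * n ≤ m →
    HomologyRank≥ subset-≟ symDiffDist (2 * (n ∸ 1)) (F n m)
    (((2 * n) C n) / 2 ∸ 1) (m C (2 * n))
theorem3p5 (suc n′) m (s≤s 2≤n′) _ =
  subst (HomologyRank≥ subset-≟ symDiffDist (2 * n′) (F n m) p) (length-F (2 * n) m)
    (homologyRank≥-spheres (λ A → subst (_≤ 2 * n′) (sym (symDiffDist-self A)) z≤n) symDiffDist-comm
                           p (length (F (2 * n) m)) sphere ∣pairs∣ separatedSpheres)
  where
  n = suc n′
  p = ((2 * n) C n) / 2 ∸ 1
  open VietorisRips subset-≟ symDiffDist (2 * n′) (F n m) (F-unique n m)
  open Spheres {m} n′ 2≤n′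
  S : Fin (length (F (2 * n) m)) → Subset m
  S = lookup (F (2 * n) m)
  ∣S∣ : ∀ j → card (S j) ≡ n + n
  ∣S∣ j = trans (F-card (∈-lookup {xs = F (2 * n) m} j)) (cong (n +_) (ℕP.+-identityʳ n))
  sphere : Fin (length (F (2 * n) m)) → MarkedSphere
  sphere j = markedSphere (S j) (∣S∣ j)
  ∣pairs∣ : ∀ j → length (MarkedSphere.pairs (sphere j)) ≡ suc p
  ∣pairs∣ j = trans (length-pairs (S j) (∣S∣ j)) (sym (central-binomial-half n′))
  separatedSpheres : ∀ j k → k ≢ j → ∃ λ B → B ∈ F n m × MarkedSphere.chosen (sphere j) B ≡ true ×
                                             B ∉ vertices (MarkedSphere.pairs (sphere k))
  separatedSpheres j k k≢j = separated (∣S∣ j) (∣S∣ k) (k≢j ∘ lookup-injective (F-unique (2 * n) m) k j)
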